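{- If $n$ is a positive integer with $d(n) = 2$, then $n \equiv -7 \pmod{12}$.
   Context: For a finite simple graph $G=(V,E)$, define $\Phi_G(S) = \{v \in V : \lvert N[v]\cap S\rvert \text{ odd}\}$ for $S \subseteq V$, where $N[v]$ is the closed neighborhood of $v$; this is $\mathbb{F}_2$-linear. $d(n)$ denotes $\dim_{\mathbb{F}_2}\ker\Phi_G$ where $G$ is the $n\times n$ grid graph (cells of an $n\times n$ array, adjacent when sharing a side). -}

module Defs where

open import Data.Bool using (Bool; true; false; _∧_; _∨_; _xor_)
open import Data.Nat using (ℕ; _≡ᵇ_; ∣_-_∣)
open import Data.Fin using (Fin; toℕ)
open import Data.List using (List; foldr; map; cartesianProduct; allFin)
open import Data.Product using (_×_; _,_; Σ; ∃)
open import Relation.Binary.PropositionalEquality using (_≡_)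

-- Vertices of the n×n grid graph: cells (i , j) of an n×n array.
Cell : ℕ → Set
Cell n = Fin n × Fin n

allCells : (n : ℕ) → List (Cell n)
allCells n = cartesianProduct (allFin n) (allFin n)

-- Subsets of V, i.e. vectors in 𝔽₂^V (Bool with xor as addition).
Subset : ℕ → Set
Subset n = Cell n → Bool

adjacent : {n : ℕ} → Cell n → Cell n → Bool
adjacent (i , j) (k , l) =
  ((toℕ i ≡ᵇ toℕ k) ∧ (∣ toℕ j - toℕ l ∣ ≡ᵇ 1))
  ∨ ((toℕ j ≡ᵇ toℕ l) ∧ (∣ toℕ i - toℕ k ∣ ≡ᵇ 1))

inClosedNbhd : {n : ℕ} → Cell n → Cell n → Bool
inClosedNbhd (i , j) (k , l) =
  ((toℕ i ≡ᵇ toℕ k) ∧ (toℕ j ≡ᵇ toℕ l)) ∨ adjacent (i , j) (k , l)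

parity : List Bool → Bool
parity = foldr _xor_ false

Φ : {n : ℕ} → Subset n → Subset n
Φ {n} S v = parity (map (λ u → inClosedNbhd v u ∧ S u) (allCells n))

InKernel : {n : ℕ} → Subset n → Set
InKernel S = ∀ v → Φ S v ≡ false

linComb : {n k : ℕ} → (Fin k → Subset n) → (Fin k → Bool) → Subset n
linComb {n} {k} b c u = parity (map (λ i → c i ∧ b i u) (allFin k))

-- dim_{𝔽₂} ker Φ_G = k : ker Φ_G has a basis of k vectors
-- (vectors lying in the kernel, linearly independent, spanning the kernel).
KernelDim : ℕ → ℕ → Set
KernelDim n k =
  Σ (Fin k → Subset n) λ b →
    (∀ i → InKernel (b i))
    × (∀ (c : Fin k → Bool) → (∀ u → linComb b c u ≡ false) → ∀ i → c i ≡ false)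
    × (∀ (S : Subset n) → InKernel S → ∃ λ (c : Fin k → Bool) → ∀ u → linComb b c u ≡ S u)

{-# OPTIONS --safe #-}
-- A kernel vector of the n × n grid, extended by zero to the lines -1 and n and then reflected in these
-- lines in both directions, becomes a 2N-periodic (N = n + 1) solution F : ℤ² → 𝔽₂ of the five-point
-- equation; conversely every such solution restricts to a kernel vector, so these mirror solutions form
-- a space of dimension d(n). The second difference Δ₁ F (i , j) = F (i - 1 , j) + F (i + 1 , j) maps this
-- space to itself. If d(n) = 2 it acts by a 2 × 2 matrix over 𝔽₂, which kills some nonzero solution F
-- by x, x + 1 or x² + x + 1. Along lines F then satisfies recurrences forcing period 2 in one direction
-- and period 3 in the other, or period 5; since F also has period 2N, vanishes on the mirror lines and
-- is not identically zero, this gives 2 ∣ N and 3 ∣ N, or 5 ∣ N. Three independent mirror solutions for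
-- N = 5 and for N = 12 remain mirror solutions for every multiple of 5, resp. 12, which rules out 5 ∣ N
-- and 12 ∣ N. Hence N ≡ 6, that is n ≡ -7 (mod 12).
module Submission where

open import Defs
open import Data.Bool using (Bool; true; false; not; _∧_; _∨_; _xor_)
import Data.Bool.Properties as Boolₚ
open import Data.Bool.Solver using (module xor-∧-Solver)
open import Data.Nat using (ℕ; zero; suc; _≤_; _<_; z≤n; s≤s; _≡ᵇ_; ∣_-_∣)
import Data.Nat as ℕ
import Data.Nat.Properties as ℕₚ
import Data.Nat.DivMod as ℕDivMod
open import Data.Fin using (Fin; toℕ; fromℕ<)
import Data.Fin.Properties as Finₚ
open import Data.List using (List; []; _∷_; _++_; map; allFin; cartesianProduct)
import Data.List.Properties as Listₚ
open import Data.Maybe using (Maybe; just; nothing)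
open import Data.Product using (Σ; ∃; _×_; _,_; proj₁; proj₂; uncurry)
open import Data.Sum using (_⊎_; inj₁; inj₂)
open import Data.Empty using (⊥; ⊥-elim)
open import Function using (_∘_; id)
open import Relation.Nullary using (¬_; yes; no)
open import Relation.Binary.Definitions using (tri<; tri≈; tri>)
open import Relation.Binary.PropositionalEquality

open xor-∧-Solver using (solve; _:+_; _:*_; _:=_; con)

true≢false : true ≢ false
true≢false ()

module Parity where

  open import Data.List using (tabulate)

  xorSum : ℕ → (ℕ → Bool) → Bool
  xorSum zero    f = false
  xorSum (suc n) f = f 0 xor xorSum n (f ∘ suc)

  xorSum-cong : ∀ n {f g : ℕ → Bool} → (∀ k → f k ≡ g k) → xorSum n f ≡ xorSum n g
  xorSum-cong zero    f≗g = refl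
  xorSum-cong (suc n) f≗g = cong₂ _xor_ (f≗g 0) (xorSum-cong n (f≗g ∘ suc))

  xorSum-false : ∀ n {f : ℕ → Bool} → (∀ k → f k ≡ false) → xorSum n f ≡ false
  xorSum-false zero    f≗0 = refl
  xorSum-false (suc n) f≗0 = cong₂ _xor_ (f≗0 0) (xorSum-false n (f≗0 ∘ suc))

  xorSum-xor : ∀ n (f g : ℕ → Bool) → xorSum n (λ k → f k xor g k) ≡ xorSum n f xor xorSum n g
  xorSum-xor zero    f g = refl
  xorSum-xor (suc n) f g = trans (cong ((f 0 xor g 0) xor_) (xorSum-xor n (f ∘ suc) (g ∘ suc)))
                                 (interchange (f 0) (g 0) _ _)
    where
    interchange : ∀ a b c d → (a xor b) xor (c xor d) ≡ (a xor c) xor (b xor d)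
    interchange = solve 4 (λ a b c d → (a :+ b) :+ (c :+ d) := (a :+ c) :+ (b :+ d)) refl

  xorSum-∧ˡ : ∀ n c (f : ℕ → Bool) → xorSum n (λ k → c ∧ f k) ≡ c ∧ xorSum n f
  xorSum-∧ˡ zero    c f = sym (Boolₚ.∧-zeroʳ c)
  xorSum-∧ˡ (suc n) c f = trans (cong ((c ∧ f 0) xor_) (xorSum-∧ˡ n c (f ∘ suc)))
                                (sym (Boolₚ.∧-distribˡ-xor c (f 0) _))

  xorSum-snoc : ∀ n (f : ℕ → Bool) → xorSum (suc n) f ≡ xorSum n f xor f n
  xorSum-snoc zero    f = Boolₚ.xor-comm (f 0) false
  xorSum-snoc (suc n) f = trans (cong (f 0 xor_) (xorSum-snoc n (f ∘ suc)))
                                (sym (Boolₚ.xor-assoc (f 0) _ _))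

  xorSum-δ : ∀ n m (h : ℕ → Bool) → (n ≤ m → h m ≡ false) → xorSum n (λ k → (m ≡ᵇ k) ∧ h k) ≡ h m
  xorSum-δ zero    m       h h-out = sym (h-out z≤n)
  xorSum-δ (suc n) zero    h h-out = trans (cong (h 0 xor_) (xorSum-false n (λ _ → refl)))
                                           (Boolₚ.xor-identityʳ (h 0))
  xorSum-δ (suc n) (suc m) h h-out = xorSum-δ n m (h ∘ suc) (h-out ∘ s≤s)

  parity-++ : ∀ xs ys → parity (xs ++ ys) ≡ parity xs xor parity ys
  parity-++ []       ys = refl
  parity-++ (x ∷ xs) ys = trans (cong (x xor_) (parity-++ xs ys)) (sym (Boolₚ.xor-assoc x _ _))

  parity-map-cong : ∀ {A : Set} (xs : List A) {f g : A → Bool} →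
                    (∀ x → f x ≡ g x) → parity (map f xs) ≡ parity (map g xs)
  parity-map-cong xs f≗g = cong parity (Listₚ.map-cong f≗g xs)

  parity-cartesianProduct : ∀ {A B : Set} (xs : List A) (ys : List B) (g : A × B → Bool) →
    parity (map g (cartesianProduct xs ys)) ≡ parity (map (λ x → parity (map (λ y → g (x , y)) ys)) xs)
  parity-cartesianProduct []       ys g = refl
  parity-cartesianProduct (x ∷ xs) ys g = begin
    parity (map g (map (x ,_) ys ++ cartesianProduct xs ys))
      ≡⟨ cong parity (Listₚ.map-++ g (map (x ,_) ys) _) ⟩
    parity (map g (map (x ,_) ys) ++ map g (cartesianProduct xs ys))
      ≡⟨ parity-++ (map g (map (x ,_) ys)) _ ⟩
    parity (map g (map (x ,_) ys)) xor parity (map g (cartesianProduct xs ys))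
      ≡⟨ cong₂ _xor_ (cong parity (sym (Listₚ.map-∘ ys))) (parity-cartesianProduct xs ys g) ⟩
    parity (map (λ y → g (x , y)) ys) xor parity (map (λ x → parity (map (λ y → g (x , y)) ys)) xs) ∎
    where open ≡-Reasoning

  parity-allFin : ∀ n (f : ℕ → Bool) → parity (map (f ∘ toℕ) (allFin n)) ≡ xorSum n f
  parity-allFin n f = trans (cong parity (Listₚ.map-tabulate {n = n} id (f ∘ toℕ))) (parity-tabulate n f)
    where
    parity-tabulate : ∀ n (f : ℕ → Bool) → parity (tabulate {n = n} (f ∘ toℕ)) ≡ xorSum n f
    parity-tabulate zero    f = refl
    parity-tabulate (suc n) f = cong (f 0 xor_) (parity-tabulate n (f ∘ suc))

  parity-allCells : ∀ n (f : ℕ → ℕ → Bool) →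
    parity (map (λ u → f (toℕ (proj₁ u)) (toℕ (proj₂ u))) (allCells n)) ≡ xorSum n (λ k → xorSum n (f k))
  parity-allCells n f = begin
    parity (map (λ u → f (toℕ (proj₁ u)) (toℕ (proj₂ u))) (allCells n))
      ≡⟨ parity-cartesianProduct (allFin n) (allFin n) _ ⟩
    parity (map (λ x → parity (map (f (toℕ x) ∘ toℕ) (allFin n))) (allFin n))
      ≡⟨ parity-map-cong (allFin n) (λ x → parity-allFin n (f (toℕ x))) ⟩
    parity (map (λ x → xorSum n (f (toℕ x))) (allFin n))
      ≡⟨ parity-allFin n (λ k → xorSum n (f k)) ⟩
    xorSum n (λ k → xorSum n (f k)) ∎
    where open ≡-Reasoning

  xorSum²-split : ∀ n (P Q R T : ℕ → Bool) (s : ℕ → ℕ → Bool) →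
    xorSum n (λ k → xorSum n (λ l → ((P k ∧ Q l) xor (R k ∧ T l)) ∧ s k l))
      ≡ xorSum n (λ k → P k ∧ xorSum n (λ l → Q l ∧ s k l)) xor xorSum n (λ k → R k ∧ xorSum n (λ l → T l ∧ s k l))
  xorSum²-split n P Q R T s = begin
    xorSum n (λ k → xorSum n (λ l → ((P k ∧ Q l) xor (R k ∧ T l)) ∧ s k l))
      ≡⟨ xorSum-cong n (λ k → trans (xorSum-cong n (λ l → factor (P k) (Q l) (R k) (T l) (s k l)))
                                    (xorSum-xor n _ _)) ⟩
    xorSum n (λ k → xorSum n (λ l → P k ∧ (Q l ∧ s k l)) xor xorSum n (λ l → R k ∧ (T l ∧ s k l)))
      ≡⟨ xorSum-xor n _ _ ⟩
    xorSum n (λ k → xorSum n (λ l → P k ∧ (Q l ∧ s k l))) xor xorSum n (λ k → xorSum n (λ l → R k ∧ (T l ∧ s k l)))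
      ≡⟨ cong₂ _xor_ (xorSum-cong n (λ k → xorSum-∧ˡ n (P k) _)) (xorSum-cong n (λ k → xorSum-∧ˡ n (R k) _)) ⟩
    xorSum n (λ k → P k ∧ xorSum n (λ l → Q l ∧ s k l)) xor xorSum n (λ k → R k ∧ xorSum n (λ l → T l ∧ s k l)) ∎
    where
    open ≡-Reasoning
    factor : ∀ p q r t x → ((p ∧ q) xor (r ∧ t)) ∧ x ≡ (p ∧ (q ∧ x)) xor (r ∧ (t ∧ x))
    factor = solve 5 (λ p q r t x → ((p :* q) :+ (r :* t)) :* x := (p :* (q :* x)) :+ (r :* (t :* x))) refl

module NumberTheory where

  open import Data.Nat using (_+_; _%_)
  open import Data.Nat.Divisibility using (_∣_; divides; ∣⇒≤; m%n≡0⇒n∣m; n∣m⇒m%n≡0)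
  open import Data.Nat.Coprimality using (Coprime)
  open import Data.Nat.Primality using (Prime; prime⇒irreducible; euclidsLemma)

  prime∤⇒coprime : ∀ {p m} → Prime p → ¬ p ∣ m → Coprime p m
  prime∤⇒coprime pp p∤m (d∣p , d∣m) with prime⇒irreducible pp d∣p
  ... | inj₁ d≡1  = d≡1
  ... | inj₂ refl = ⊥-elim (p∤m d∣m)

  odd-prime∣double⇒∣ : ∀ {p m} → Prime p → 2 < p → p ∣ m + m → p ∣ m
  odd-prime∣double⇒∣ {p} {m} pp 2<p p∣m+m
    with euclidsLemma 2 m pp (subst (p ∣_) (cong (m +_) (sym (ℕₚ.+-identityʳ m))) p∣m+m)
  ... | inj₁ p∣2 = ⊥-elim (ℕₚ.<⇒≱ 2<p (∣⇒≤ p∣2))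
  ... | inj₂ p∣m = p∣m

  ∤2⇒%2≡1 : ∀ m → ¬ 2 ∣ m → m % 2 ≡ 1
  ∤2⇒%2≡1 m 2∤m with m % 2 in eq | ℕDivMod.m%n<n m 2
  ... | 0           | _ = ⊥-elim (2∤m (m%n≡0⇒n∣m m 2 eq))
  ... | 1           | _ = refl
  ... | suc (suc _) | s≤s (s≤s ())

  2∣∧3∣∧12∤⇒12∣+6 : ∀ m → 2 ∣ m → 3 ∣ m → ¬ 12 ∣ m → (m + 6) % 12 ≡ 0
  2∣∧3∣∧12∤⇒12∣+6 m 2∣m 3∣m 12∤m = trans (ℕDivMod.%-distribˡ-+ m 6 12)
    (residue (m % 12) (ℕDivMod.m%n<n m 12)
             (trans (ℕDivMod.m∣n⇒o%n%m≡o%m 2 12 m (divides 6 refl)) (n∣m⇒m%n≡0 m 2 2∣m))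
             (trans (ℕDivMod.m∣n⇒o%n%m≡o%m 3 12 m (divides 4 refl)) (n∣m⇒m%n≡0 m 3 3∣m))
             (12∤m ∘ m%n≡0⇒n∣m m 12))
    where
    residue : ∀ r → r < 12 → r % 2 ≡ 0 → r % 3 ≡ 0 → r ≢ 0 → (r + 6) % 12 ≡ 0
    residue 0  _ _  _  r≢0 = ⊥-elim (r≢0 refl)
    residue 1  _ () _  _
    residue 2  _ _  () _
    residue 3  _ () _  _
    residue 4  _ _  () _
    residue 5  _ () _  _
    residue 6  _ _  _  _   = refl
    residue 7  _ () _  _
    residue 8  _ _  () _
    residue 9  _ () _  _
    residue 10 _ _  () _
    residue 11 _ () _  _
    residue (suc (suc (suc (suc (suc (suc (suc (suc (suc (suc (suc (suc _))))))))))))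
            (s≤s (s≤s (s≤s (s≤s (s≤s (s≤s (s≤s (s≤s (s≤s (s≤s (s≤s (s≤s ())))))))))))) _ _ _

module Periods where

  open Parity using (xorSum; xorSum-cong; xorSum-snoc)
  open import Data.Integer using (ℤ; +_; -[1+_]; _+_; _-_; _*_; -_; 1ℤ)
  import Data.Integer.Properties as ℤₚ
  open import Data.Integer.DivMod using (_%ℕ_; _/ℕ_; a≡a%ℕn+[a/ℕn]*n; n%ℕd<d)
  open import Data.Integer.Tactic.RingSolver using (solve-∀)
  open import Data.Nat.GCD using (module Bézout)
  open import Data.Nat.Coprimality using (Coprime; coprime-Bézout)

  Period : (ℤ → Bool) → ℤ → Set
  Period g p = ∀ x → g (x + p) ≡ g x

  xor≡false⇒≡ : ∀ {a b} → a xor b ≡ false → a ≡ b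
  xor≡false⇒≡ {false} {false} _ = refl
  xor≡false⇒≡ {true}  {true}  _ = refl

  module _ {g : ℤ → Bool} where

    period-neg : ∀ {p} → Period g p → Period g (- p)
    period-neg {p} per x = trans (sym (per (x - p))) (cong g (cancel x p))
      where
      cancel : ∀ x p → x - p + p ≡ x
      cancel = solve-∀

    period-ℕ* : ∀ {p} → Period g (+ p) → ∀ k → Period g (+ (k ℕ.* p))
    period-ℕ* per zero    x = cong g (ℤₚ.+-identityʳ x)
    period-ℕ* {p} per (suc k) x =
      trans (cong g (sym (ℤₚ.+-assoc x (+ p) (+ (k ℕ.* p))))) (trans (period-ℕ* per k (x + + p)) (per x))

    period-ℤ* : ∀ {p} → Period g (+ p) → ∀ q → Period g (q * + p)
    period-ℤ* {p} per (+ k)    = subst (Period g) (ℤₚ.pos-* k p) (period-ℕ* per k)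
    period-ℤ* {p} per -[1+ k ] = subst (Period g) (ℤₚ.neg-distribˡ-* (+ suc k) (+ p))
                                       (period-neg (period-ℤ* per (+ suc k)))

    period-1⇒constant : Period g 1ℤ → ∀ x y → g x ≡ g y
    period-1⇒constant per x y = trans (cong g (shift x y)) (period-ℤ* per (x - y) y)
      where
      shift : ∀ x y → x ≡ y + (x - y) * 1ℤ
      shift = solve-∀

    bézout-period : ∀ {c d u v} → Period g (+ c) → Period g (+ d) → 1 ℕ.+ v ℕ.* d ≡ u ℕ.* c → Period g 1ℤ
    bézout-period {c} {d} {u} {v} per-c per-d eq t = begin
      g (t + 1ℤ)                 ≡⟨ period-ℕ* per-d v (t + 1ℤ) ⟨
      g (t + 1ℤ + + (v ℕ.* d))   ≡⟨ cong g (ℤₚ.+-assoc t 1ℤ (+ (v ℕ.* d))) ⟩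
      g (t + + (1 ℕ.+ v ℕ.* d))  ≡⟨ cong (λ m → g (t + + m)) eq ⟩
      g (t + + (u ℕ.* c))        ≡⟨ period-ℕ* per-c u t ⟩
      g t                        ∎
      where open ≡-Reasoning

    coprime-periods : ∀ {a b} → Period g (+ a) → Period g (+ b) → Coprime a b → Period g 1ℤ
    coprime-periods per-a per-b a⊥b with coprime-Bézout a⊥b
    ... | Bézout.+- x y 1+yb≡xa = bézout-period {u = x} {v = y} per-a per-b 1+yb≡xa
    ... | Bézout.-+ x y 1+xa≡yb = bézout-period {u = y} {v = x} per-b per-a 1+xa≡yb

    window⇒period : ∀ p → (∀ x → xorSum p (λ k → g (x + + k)) ≡ false) → Period g (+ p)
    window⇒period zero    _      x = cong g (ℤₚ.+-identityʳ x)
    window⇒period (suc p) window x = begin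
      g (x + + suc p)                              ≡⟨ cong g (ℤₚ.+-assoc x 1ℤ (+ p)) ⟨
      g (x + 1ℤ + + p)                             ≡⟨ xor≡false⇒≡ (trans (sym (xorSum-snoc p _)) (window (x + 1ℤ))) ⟨
      xorSum p (λ k → g (x + 1ℤ + + k))            ≡⟨ xorSum-cong p (λ k → cong g (ℤₚ.+-assoc x 1ℤ (+ k))) ⟩
      xorSum p (λ k → g (x + + suc k))             ≡⟨ xor≡false⇒≡ (window x) ⟨
      g (x + + 0)                                  ≡⟨ cong g (ℤₚ.+-identityʳ x) ⟩
      g x                                          ∎
      where open ≡-Reasoning

    period-2-vanishing : Period g (+ 2) → g (+ 0) ≡ false → g (+ 1) ≡ false → ∀ x → g x ≡ false
    period-2-vanishing per g0 g1 x with x %ℕ 2 | n%ℕd<d x 2 | a≡a%ℕn+[a/ℕn]*n x 2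
    ... | 0 | _ | x≡ = trans (cong g x≡) (trans (period-ℤ* per (x /ℕ 2) (+ 0)) g0)
    ... | 1 | _ | x≡ = trans (cong g x≡) (trans (period-ℤ* per (x /ℕ 2) (+ 1)) g1)
    ... | suc (suc _) | s≤s (s≤s ()) | _

  Δ : (ℤ → Bool) → ℤ → Bool
  Δ g x = g (x - 1ℤ) xor g (x + 1ℤ)

  module _ {g : ℤ → Bool} where

    Δ≡0⇒period-2 : (∀ x → Δ g x ≡ false) → Period g (+ 2)
    Δ≡0⇒period-2 Δg≡0 x = begin
      g (x + + 2)            ≡⟨ cong g (two x) ⟩
      g (x + 1ℤ + 1ℤ)        ≡⟨ xor≡false⇒≡ (Δg≡0 (x + 1ℤ)) ⟨
      g (x + 1ℤ - 1ℤ)        ≡⟨ cong g (back x) ⟩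
      g x                    ∎
      where
      open ≡-Reasoning
      two : ∀ x → x + + 2 ≡ x + 1ℤ + 1ℤ
      two = solve-∀
      back : ∀ x → x + 1ℤ - 1ℤ ≡ x
      back = solve-∀

    Δ≡id⇒period-3 : (∀ x → Δ g x ≡ g x) → Period g (+ 3)
    Δ≡id⇒period-3 Δg≡g = window⇒period 3 λ x → begin
      g (x + + 0) xor (g (x + + 1) xor (g (x + + 2) xor false))
        ≡⟨ cong₂ _xor_ (cong g (e₀ x)) (cong₂ _xor_ (cong g (e₁ x)) (cong (λ t → g t xor false) (e₂ x))) ⟩
      g (x + 1ℤ - 1ℤ) xor (g (x + 1ℤ) xor (g (x + 1ℤ + 1ℤ) xor false))
        ≡⟨ regroup (g (x + 1ℤ - 1ℤ)) (g (x + 1ℤ)) (g (x + 1ℤ + 1ℤ)) ⟩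
      Δ g (x + 1ℤ) xor g (x + 1ℤ)
        ≡⟨ cong (_xor g (x + 1ℤ)) (Δg≡g (x + 1ℤ)) ⟩
      g (x + 1ℤ) xor g (x + 1ℤ)
        ≡⟨ Boolₚ.xor-same (g (x + 1ℤ)) ⟩
      false ∎
      where
      open ≡-Reasoning
      e₀ : ∀ x → x + + 0 ≡ x + 1ℤ - 1ℤ
      e₀ = solve-∀
      e₁ : ∀ x → x + + 1 ≡ x + 1ℤ
      e₁ = solve-∀
      e₂ : ∀ x → x + + 2 ≡ x + 1ℤ + 1ℤ
      e₂ = solve-∀
      regroup : ∀ a b c → a xor (b xor (c xor false)) ≡ (a xor c) xor b
      regroup = solve 3 (λ a b c → a :+ (b :+ (c :+ con false)) := (a :+ c) :+ b) refl

    Δ²+Δ+1≡0⇒period-5 : (∀ x → Δ (Δ g) x xor (Δ g x xor g x) ≡ false) → Period g (+ 5)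
    Δ²+Δ+1≡0⇒period-5 rel = window⇒period 5 λ x → begin
      g (x + + 0) xor (g (x + + 1) xor (g (x + + 2) xor (g (x + + 3) xor (g (x + + 4) xor false))))
        ≡⟨ regroup (g (x + + 0)) (g (x + + 1)) (g (x + + 2)) (g (x + + 3)) (g (x + + 4)) ⟩
      ((g (x + + 0) xor g (x + + 2)) xor (g (x + + 2) xor g (x + + 4))) xor ((g (x + + 1) xor g (x + + 3)) xor g (x + + 2))
        ≡⟨ cong₂ _xor_ (cong₂ _xor_ (cong₂ _xor_ (cong g (e₀ x)) (cong g (e₂ x)))
                                    (cong₂ _xor_ (cong g (e₂′ x)) (cong g (e₄ x))))
                       (cong₂ _xor_ (cong₂ _xor_ (cong g (e₁ x)) (cong g (e₃ x))) refl) ⟩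
      Δ (Δ g) (x + + 2) xor (Δ g (x + + 2) xor g (x + + 2))
        ≡⟨ rel (x + + 2) ⟩
      false ∎
      where
      open ≡-Reasoning
      e₀ : ∀ x → x + + 0 ≡ x + + 2 - 1ℤ - 1ℤ
      e₀ = solve-∀
      e₁ : ∀ x → x + + 1 ≡ x + + 2 - 1ℤ
      e₁ = solve-∀
      e₂ : ∀ x → x + + 2 ≡ x + + 2 - 1ℤ + 1ℤ
      e₂ = solve-∀
      e₂′ : ∀ x → x + + 2 ≡ x + + 2 + 1ℤ - 1ℤ
      e₂′ = solve-∀
      e₃ : ∀ x → x + + 3 ≡ x + + 2 + 1ℤ
      e₃ = solve-∀
      e₄ : ∀ x → x + + 4 ≡ x + + 2 + 1ℤ + 1ℤ
      e₄ = solve-∀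
      regroup : ∀ a b c d e → a xor (b xor (c xor (d xor (e xor false))))
                              ≡ ((a xor c) xor (c xor e)) xor ((b xor d) xor c)
      regroup = solve 5 (λ a b c d e → a :+ (b :+ (c :+ (d :+ (e :+ con false))))
                                      := ((a :+ c) :+ (c :+ e)) :+ ((b :+ d) :+ c)) refl

module LocalForm where

  open Parity
  open Periods using (Δ)
  open import Data.Integer using (ℤ; +_; -[1+_]; _+_; _-_; 1ℤ; -1ℤ)

  Δ₁ Δ₂ fivePoint : (ℤ → ℤ → Bool) → ℤ → ℤ → Bool
  Δ₁ F i j = Δ (λ x → F x j) i
  Δ₂ F i = Δ (F i)
  fivePoint F i j = F i j xor (Δ₁ F i j xor Δ₂ F i j)

  Local : (ℤ → ℤ → Bool) → Set
  Local F = ∀ i j → fivePoint F i j ≡ false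

  module _ {n : ℕ} where

    toFin? : ℤ → Maybe (Fin n)
    toFin? (+ k) with k ℕ.<? n
    ... | yes k<n = just (fromℕ< k<n)
    ... | no  _   = nothing
    toFin? -[1+ _ ] = nothing

    toFin?-toℕ : ∀ (a : Fin n) → toFin? (+ toℕ a) ≡ just a
    toFin?-toℕ a with toℕ a ℕ.<? n
    ... | yes a<n = cong just (Finₚ.fromℕ<-toℕ a a<n)
    ... | no  a≮n = ⊥-elim (a≮n (Finₚ.toℕ<n a))

    toFin?-≥ : ∀ k → n ≤ k → toFin? (+ k) ≡ nothing
    toFin?-≥ k n≤k with k ℕ.<? n
    ... | yes k<n = ⊥-elim (ℕₚ.<⇒≱ k<n n≤k)
    ... | no  _   = refl

    cellAt : Subset n → Maybe (Fin n) → Maybe (Fin n) → Bool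
    cellAt S (just a) (just b) = S (a , b)
    cellAt S _        _        = false

    zeroExt : Subset n → ℤ → ℤ → Bool
    zeroExt S x y = cellAt S (toFin? x) (toFin? y)

    zeroExt-toℕ : ∀ S (a b : Fin n) → zeroExt S (+ toℕ a) (+ toℕ b) ≡ S (a , b)
    zeroExt-toℕ S a b = cong₂ (cellAt S) (toFin?-toℕ a) (toFin?-toℕ b)

    zeroExt-outˡ : ∀ S x y → toFin? x ≡ nothing → zeroExt S x y ≡ false
    zeroExt-outˡ S x y x-out = cong (λ m → cellAt S m (toFin? y)) x-out

    zeroExt-outʳ : ∀ S x y → toFin? y ≡ nothing → zeroExt S x y ≡ false
    zeroExt-outʳ S x y y-out = trans (cong (cellAt S (toFin? x)) y-out) (cellAt-nothingʳ (toFin? x))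
      where
      cellAt-nothingʳ : ∀ m → cellAt S m nothing ≡ false
      cellAt-nothingʳ (just _) = refl
      cellAt-nothingʳ nothing  = refl

    cellAt-lincomb : ∀ {S T U} a b → (∀ u → U u ≡ (a ∧ S u) xor (b ∧ T u)) →
                     ∀ m m′ → cellAt U m m′ ≡ (a ∧ cellAt S m m′) xor (b ∧ cellAt T m m′)
    cellAt-lincomb a b U≡ (just x) (just y) = U≡ (x , y)
    cellAt-lincomb a b U≡ (just _) nothing  = sym (cong₂ _xor_ (Boolₚ.∧-zeroʳ a) (Boolₚ.∧-zeroʳ b))
    cellAt-lincomb a b U≡ nothing  _        = sym (cong₂ _xor_ (Boolₚ.∧-zeroʳ a) (Boolₚ.∧-zeroʳ b))

  record Vanishes (n : ℕ) (g : ℤ → Bool) : Set where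
    constructor vanishes
    field
      at-1    : g -1ℤ ≡ false
      beyond : ∀ m → n ≤ m → g (+ m) ≡ false

  module _ {n : ℕ} {g : ℤ → Bool} (g-vanishes : Vanishes n g) where

    sift : ∀ a → xorSum n (λ k → (a ≡ᵇ k) ∧ g (+ k)) ≡ g (+ a)
    sift a = xorSum-δ n a (g ∘ +_) (Vanishes.beyond g-vanishes a)

    sift-suc : ∀ a → xorSum n (λ k → (suc a ≡ᵇ k) ∧ g (+ k)) ≡ g (+ a + 1ℤ)
    sift-suc a = trans (sift (suc a)) (cong (g ∘ +_) (ℕₚ.+-comm 1 a))

    sift-pred : ∀ a → xorSum n (λ k → (a ≡ᵇ suc k) ∧ g (+ k)) ≡ g (+ a - 1ℤ)
    sift-pred zero    = trans (xorSum-false n (λ _ → refl)) (sym (Vanishes.at-1 g-vanishes))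
    sift-pred (suc a) = sift a

    sift-xor : ∀ (X Y : ℕ → Bool) →
      xorSum n (λ k → (X k xor Y k) ∧ g (+ k)) ≡ xorSum n (λ k → X k ∧ g (+ k)) xor xorSum n (λ k → Y k ∧ g (+ k))
    sift-xor X Y = trans (xorSum-cong n (λ k → Boolₚ.∧-distribʳ-xor (g (+ k)) (X k) (Y k)))
                         (xorSum-xor n _ _)

    sift-adjacent : ∀ a → xorSum n (λ k → ((suc a ≡ᵇ k) xor (a ≡ᵇ suc k)) ∧ g (+ k))
                          ≡ g (+ a + 1ℤ) xor g (+ a - 1ℤ)
    sift-adjacent a = trans (sift-xor (suc a ≡ᵇ_) (λ k → a ≡ᵇ suc k)) (cong₂ _xor_ (sift-suc a) (sift-pred a))

    sift-closed : ∀ a → xorSum n (λ k → ((a ≡ᵇ k) xor ((suc a ≡ᵇ k) xor (a ≡ᵇ suc k))) ∧ g (+ k))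
                        ≡ g (+ a) xor (g (+ a + 1ℤ) xor g (+ a - 1ℤ))
    sift-closed a = trans (sift-xor (a ≡ᵇ_) _) (cong₂ _xor_ (sift a) (sift-adjacent a))

  adjacentℕ closedℕ : ℕ → ℕ → Bool
  adjacentℕ a x = (suc a ≡ᵇ x) xor (a ≡ᵇ suc x)
  closedℕ a x = (a ≡ᵇ x) xor adjacentℕ a x

  ∣-∣≡ᵇ1 : ∀ x y → (∣ x - y ∣ ≡ᵇ 1) ≡ adjacentℕ x y
  ∣-∣≡ᵇ1 zero    zero          = refl
  ∣-∣≡ᵇ1 zero    (suc zero)    = refl
  ∣-∣≡ᵇ1 zero    (suc (suc y)) = refl
  ∣-∣≡ᵇ1 (suc x) zero          = refl
  ∣-∣≡ᵇ1 (suc x) (suc y)       = ∣-∣≡ᵇ1 x y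

  ≡ᵇ∧∣-∣≡ᵇ1 : ∀ x y → (x ≡ᵇ y) ∧ (∣ x - y ∣ ≡ᵇ 1) ≡ false
  ≡ᵇ∧∣-∣≡ᵇ1 zero    zero    = refl
  ≡ᵇ∧∣-∣≡ᵇ1 zero    (suc y) = refl
  ≡ᵇ∧∣-∣≡ᵇ1 (suc x) zero    = refl
  ≡ᵇ∧∣-∣≡ᵇ1 (suc x) (suc y) = ≡ᵇ∧∣-∣≡ᵇ1 x y

  exclusive-∨ : ∀ A B E F → A ∧ E ≡ false → B ∧ F ≡ false →
                (A ∧ B) ∨ ((A ∧ F) ∨ (B ∧ E)) ≡ (A ∧ (B xor F)) xor (E ∧ B)
  exclusive-∨ false false false _     _    _    = refl
  exclusive-∨ false false true  _     _    _    = refl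
  exclusive-∨ false true  false false _    refl = refl
  exclusive-∨ false true  true  false _    refl = refl
  exclusive-∨ true  false false false refl _    = refl
  exclusive-∨ true  false false true  refl _    = refl
  exclusive-∨ true  true  false false refl refl = refl

  inClosedNbhd-expand : ∀ {n} (i j k l : Fin n) →
    inClosedNbhd (i , j) (k , l)
      ≡ ((toℕ i ≡ᵇ toℕ k) ∧ closedℕ (toℕ j) (toℕ l)) xor (adjacentℕ (toℕ i) (toℕ k) ∧ (toℕ j ≡ᵇ toℕ l))
  inClosedNbhd-expand i j k l =
    trans (exclusive-∨ (a ≡ᵇ x) (b ≡ᵇ y) (∣ a - x ∣ ≡ᵇ 1) (∣ b - y ∣ ≡ᵇ 1)
                       (≡ᵇ∧∣-∣≡ᵇ1 a x) (≡ᵇ∧∣-∣≡ᵇ1 b y))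
          (cong₂ (λ E F → ((a ≡ᵇ x) ∧ ((b ≡ᵇ y) xor F)) xor (E ∧ (b ≡ᵇ y)))
                 (∣-∣≡ᵇ1 a x) (∣-∣≡ᵇ1 b y))
    where
    a = toℕ i
    b = toℕ j
    x = toℕ k
    y = toℕ l

  Φ-fivePoint : ∀ {n} (S : Subset n) (a b : Fin n) → Φ S (a , b) ≡ fivePoint (zeroExt S) (+ toℕ a) (+ toℕ b)
  Φ-fivePoint {n} S a b = begin
    Φ S (a , b)
      ≡⟨ parity-map-cong (allCells n) (λ (k , l) → cong₂ _∧_ (inClosedNbhd-expand a b k l) (sym (zeroExt-toℕ S k l))) ⟩
    parity (map (λ u → G (toℕ (proj₁ u)) (toℕ (proj₂ u))) (allCells n))
      ≡⟨ parity-allCells n G ⟩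
    xorSum n (λ k → xorSum n (G k))
      ≡⟨ xorSum²-split n (A ≡ᵇ_) (closedℕ B) (adjacentℕ A) (B ≡ᵇ_) z ⟩
    xorSum n (λ k → (A ≡ᵇ k) ∧ xorSum n (λ l → closedℕ B l ∧ z k l))
      xor xorSum n (λ k → adjacentℕ A k ∧ xorSum n (λ l → (B ≡ᵇ l) ∧ z k l))
      ≡⟨ cong₂ _xor_
           (trans (xorSum-cong n (λ k → cong ((A ≡ᵇ k) ∧_) (sift-closed (row-vanishes k) B))) (sift closed-column-vanishes A))
           (trans (xorSum-cong n (λ k → cong (adjacentℕ A k ∧_) (sift (row-vanishes k) B)))
                  (sift-adjacent (column-vanishes B') A)) ⟩
    (Z A' B' xor (Z A' (B' + 1ℤ) xor Z A' (B' - 1ℤ))) xor (Z (A' + 1ℤ) B' xor Z (A' - 1ℤ) B')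
      ≡⟨ regroup (Z A' B') (Z A' (B' + 1ℤ)) (Z A' (B' - 1ℤ)) (Z (A' + 1ℤ) B') (Z (A' - 1ℤ) B') ⟩
    fivePoint Z A' B' ∎
    where
    open ≡-Reasoning
    A = toℕ a
    B = toℕ b
    A' = + A
    B' = + B
    Z = zeroExt S
    z : ℕ → ℕ → Bool
    z k l = Z (+ k) (+ l)
    G : ℕ → ℕ → Bool
    G k l = (((A ≡ᵇ k) ∧ closedℕ B l) xor (adjacentℕ A k ∧ (B ≡ᵇ l))) ∧ z k l
    row-vanishes : ∀ k → Vanishes n (Z (+ k))
    row-vanishes k = vanishes (zeroExt-outʳ S (+ k) -1ℤ refl) (λ m n≤m → zeroExt-outʳ S (+ k) (+ m) (toFin?-≥ m n≤m))
    column-vanishes : ∀ y → Vanishes n (λ x → Z x y)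
    column-vanishes y = vanishes refl (λ m n≤m → zeroExt-outˡ S (+ m) y (toFin?-≥ m n≤m))
    closed-column-vanishes : Vanishes n (λ x → Z x B' xor (Z x (B' + 1ℤ) xor Z x (B' - 1ℤ)))
    closed-column-vanishes = vanishes refl λ m n≤m →
      cong₂ _xor_ (beyond (column-vanishes B') m n≤m)
                  (cong₂ _xor_ (beyond (column-vanishes (B' + 1ℤ)) m n≤m) (beyond (column-vanishes (B' - 1ℤ)) m n≤m))
      where open Vanishes
    regroup : ∀ c u d r l → (c xor (u xor d)) xor (r xor l) ≡ c xor ((l xor r) xor (d xor u))
    regroup = solve 5 (λ c u d r l → (c :+ (u :+ d)) :+ (r :+ l) := c :+ ((l :+ r) :+ (d :+ u))) refl

module Residues (M : ℕ) .{{_ : ℕ.NonZero M}} where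

  open import Data.Integer using (+_; -[1+_]; _+_; _-_; _*_; -_)
  import Data.Integer.Properties as ℤₚ
  open import Data.Integer.DivMod using (_%ℕ_; _/ℕ_; a≡a%ℕn+[a/ℕn]*n; n%ℕd<d)
  open import Data.Integer.Tactic.RingSolver using (solve-∀)

  private
    no-wraparound : ∀ {r s} k → r < M → + r ≡ + s + + suc k * + M → ⊥
    no-wraparound {r} {s} k r<M eq = ℕₚ.<⇒≱ r<M (begin
      M                          ≤⟨ ℕₚ.m≤m+n M (k ℕ.* M) ⟩
      suc k ℕ.* M                ≤⟨ ℕₚ.m≤n+m _ s ⟩
      s ℕ.+ suc k ℕ.* M          ≡⟨ ℤₚ.+-injective (trans eq (cong (_+_ (+ s)) (sym (ℤₚ.pos-* (suc k) M)))) ⟨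
      r                          ∎)
      where open ℕₚ.≤-Reasoning

  remainder-unique : ∀ {r s} q q′ → r < M → s < M → + r + q * + M ≡ + s + q′ * + M → r ≡ s
  remainder-unique {r} {s} q q′ r<M s<M eq = from-difference (q′ - q) (isolate (+ r) (+ s) q q′ (+ M) eq)
    where
    isolate : ∀ a b q q′ m → a + q * m ≡ b + q′ * m → a ≡ b + (q′ - q) * m
    isolate a b q q′ m e = trans (cancel a q m) (trans (cong (_- q * m) e) (regroup b q′ q m))
      where
      cancel : ∀ a q m → a ≡ a + q * m - q * m
      cancel = solve-∀
      regroup : ∀ b q′ q m → b + q′ * m - q * m ≡ b + (q′ - q) * m
      regroup = solve-∀
    swap : ∀ a b c m → a ≡ b + (- c) * m → b ≡ a + c * m
    swap a b c m e = trans (cancel b c m) (cong (_+ c * m) (sym e))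
      where
      cancel : ∀ b c m → b ≡ b + (- c) * m + c * m
      cancel = solve-∀
    from-difference : ∀ d → + r ≡ + s + d * + M → r ≡ s
    from-difference (+ zero)  e = ℤₚ.+-injective (trans e (ℤₚ.+-identityʳ (+ s)))
    from-difference (+ suc k) e = ⊥-elim (no-wraparound k r<M e)
    from-difference -[1+ k ]  e = ⊥-elim (no-wraparound k s<M (swap (+ r) (+ s) (+ suc k) (+ M) e))

  %ℕ-unique : ∀ x r q → r < M → x ≡ + r + q * + M → x %ℕ M ≡ r
  %ℕ-unique x r q r<M x≡ =
    remainder-unique (x /ℕ M) q (n%ℕd<d x M) r<M (trans (sym (a≡a%ℕn+[a/ℕn]*n x M)) x≡)

module Mirrors where

  open Periods
  open NumberTheory
  open import Data.Integer using (ℤ; +_; _+_; _-_; _*_; -_; 1ℤ; -1ℤ)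
  import Data.Integer.Properties as ℤₚ
  open import Data.Integer.Tactic.RingSolver using (solve-∀)
  open import Data.Nat.Divisibility using (_∣_; _∣?_)
  open import Data.Nat.Primality using (Prime)

  record Mirror (N : ℕ) (g : ℤ → Bool) : Set where
    field
      periodic : Period g (+ (N ℕ.+ N))
      reflect  : ∀ x → g (- x - + 2) ≡ g x
      at-1     : g -1ℤ ≡ false
      at-N-1   : g (+ N - 1ℤ) ≡ false

  open Mirror public

  module _ {N : ℕ} where

    mirror-xor : ∀ {g h} → Mirror N g → Mirror N h → Mirror N (λ x → g x xor h x)
    mirror-xor mg mh = record
      { periodic = λ x → cong₂ _xor_ (periodic mg x) (periodic mh x)
      ; reflect  = λ x → cong₂ _xor_ (reflect mg x) (reflect mh x)
      ; at-1     = cong₂ _xor_ (at-1 mg) (at-1 mh)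
      ; at-N-1   = cong₂ _xor_ (at-N-1 mg) (at-N-1 mh)
      }

    mirror-∧ : ∀ c {g} → Mirror N g → Mirror N (λ x → c ∧ g x)
    mirror-∧ c mg = record
      { periodic = cong (c ∧_) ∘ periodic mg
      ; reflect  = cong (c ∧_) ∘ reflect mg
      ; at-1     = trans (cong (c ∧_) (at-1 mg)) (Boolₚ.∧-zeroʳ c)
      ; at-N-1   = trans (cong (c ∧_) (at-N-1 mg)) (Boolₚ.∧-zeroʳ c)
      }

    mirror-Δ : ∀ {g} → Mirror N g → Mirror N (Δ g)
    mirror-Δ {g} mg = record
      { periodic = λ x → cong₂ _xor_ (trans (cong g (commute-₋ x (+ (N ℕ.+ N)))) (periodic mg (x - 1ℤ)))
                                     (trans (cong g (commute-₊ x (+ (N ℕ.+ N)))) (periodic mg (x + 1ℤ)))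
      ; reflect  = λ x → trans (cong₂ _xor_ (trans (cong g (reflect-₋ x)) (reflect mg (x + 1ℤ)))
                                            (trans (cong g (reflect-₊ x)) (reflect mg (x - 1ℤ))))
                               (Boolₚ.xor-comm (g (x + 1ℤ)) (g (x - 1ℤ)))
      ; at-1     = trans (cong (_xor g (+ 0)) (reflect mg (+ 0))) (Boolₚ.xor-same (g (+ 0)))
      ; at-N-1   = trans (cong (g (+ N - 1ℤ - 1ℤ) xor_) beyond-N-1) (Boolₚ.xor-same (g (+ N - 1ℤ - 1ℤ)))
      }
      where
      commute-₋ : ∀ x m → x + m - 1ℤ ≡ x - 1ℤ + m
      commute-₋ = solve-∀
      commute-₊ : ∀ x m → x + m + 1ℤ ≡ x + 1ℤ + m
      commute-₊ = solve-∀
      reflect-₋ : ∀ x → - x - + 2 - 1ℤ ≡ - (x + 1ℤ) - + 2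
      reflect-₋ = solve-∀
      reflect-₊ : ∀ x → - x - + 2 + 1ℤ ≡ - (x - 1ℤ) - + 2
      reflect-₊ = solve-∀
      beyond-N-1 : g (+ N - 1ℤ + 1ℤ) ≡ g (+ N - 1ℤ - 1ℤ)
      beyond-N-1 = begin
        g (+ N - 1ℤ + 1ℤ)             ≡⟨ cong g (wrap (+ N)) ⟩
        g (- + N + (+ N + + N))       ≡⟨ periodic mg (- + N) ⟩
        g (- + N)                     ≡⟨ cong g (unreflect (+ N)) ⟩
        g (- (+ N - 1ℤ - 1ℤ) - + 2)   ≡⟨ reflect mg (+ N - 1ℤ - 1ℤ) ⟩
        g (+ N - 1ℤ - 1ℤ)             ∎
        where
        open ≡-Reasoning
        wrap : ∀ n → n - 1ℤ + 1ℤ ≡ - n + (n + n)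
        wrap = solve-∀
        unreflect : ∀ n → - n ≡ - (n - 1ℤ - 1ℤ) - + 2
        unreflect = solve-∀

    mirror-zeros : ∀ {g} → Mirror N g → ∀ t → g (+ (t ℕ.* N) - 1ℤ) ≡ false
    mirror-zeros     mg zero          = at-1 mg
    mirror-zeros {g} mg (suc zero)    = trans (cong (λ m → g (+ m - 1ℤ)) (ℕₚ.+-identityʳ N)) (at-N-1 mg)
    mirror-zeros {g} mg (suc (suc t)) =
      trans (cong g (regroup (+ N) (+ (t ℕ.* N)))) (trans (periodic mg _) (mirror-zeros mg t))
      where
      regroup : ∀ a b → a + (a + b) - 1ℤ ≡ b - 1ℤ + (a + a)
      regroup = solve-∀

    mirror-multiple : ∀ {g} → Mirror N g → ∀ k → Mirror (suc k ℕ.* N) g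
    mirror-multiple {g} mg k = record
      { periodic = subst (Period g ∘ +_) (ℕₚ.*-distribˡ-+ (suc k) N N) (period-ℕ* (periodic mg) (suc k))
      ; reflect  = reflect mg
      ; at-1     = at-1 mg
      ; at-N-1   = mirror-zeros mg (suc k)
      }

    mirror-period-2 : ∀ {g} → Mirror N g → Period g (+ 2) → ∀ x₀ → g x₀ ≡ true → 2 ∣ N
    mirror-period-2 {g} mg per x₀ gx₀ with 2 ∣? N
    ... | yes 2∣N = 2∣N
    ... | no  2∤N = ⊥-elim (true≢false (trans (sym gx₀) (period-2-vanishing per g0 g1 x₀)))
      where
      g1 : g (+ 1) ≡ false
      g1 = trans (per -1ℤ) (at-1 mg)
      N≡ : N ≡ 1 ℕ.+ N ℕ./ 2 ℕ.* 2
      N≡ = trans (ℕDivMod.m≡m%n+[m/n]*n N 2) (cong (ℕ._+ N ℕ./ 2 ℕ.* 2) (∤2⇒%2≡1 N 2∤N))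
      g0 : g (+ 0) ≡ false
      g0 = begin
        g (+ 0)                            ≡⟨ period-ℤ* per (+ (N ℕ./ 2)) (+ 0) ⟨
        g (+ 0 + + (N ℕ./ 2) * + 2)        ≡⟨ cong g (ℤₚ.+-identityˡ _) ⟩
        g (+ (N ℕ./ 2) * + 2)              ≡⟨ cong g (ℤₚ.pos-* (N ℕ./ 2) 2) ⟨
        g (+ suc (N ℕ./ 2 ℕ.* 2) - 1ℤ)     ≡⟨ cong (λ m → g (+ m - 1ℤ)) N≡ ⟨
        g (+ N - 1ℤ)                       ≡⟨ at-N-1 mg ⟩
        false                              ∎
        where open ≡-Reasoning

    mirror-period-prime : ∀ {g p} → Prime p → 2 < p → Mirror N g → Period g (+ p) → ∀ x₀ → g x₀ ≡ true → p ∣ N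
    mirror-period-prime {g} {p} pp 2<p mg per x₀ gx₀ with p ∣? N
    ... | yes p∣N = p∣N
    ... | no  p∤N = ⊥-elim (true≢false (trans (sym gx₀) (trans (period-1⇒constant per-1 x₀ -1ℤ) (at-1 mg))))
      where
      per-1 : Period g 1ℤ
      per-1 = coprime-periods per (periodic mg) (prime∤⇒coprime pp (p∤N ∘ odd-prime∣double⇒∣ pp 2<p))

module LinearAlgebra₂ where

  open import Data.Vec using (Vec; []; _∷_; lookup; tabulate)
  import Data.Vec.Properties as Vecₚ
  open import Relation.Nullary.Decidable using (dec-true; does)

  entries₃ : (Fin 3 → Fin 3 → Bool) → List Bool
  entries₃ m = map (uncurry m) (cartesianProduct (allFin 3) (allFin 3))

  identity₃ : List Bool
  identity₃ = true ∷ false ∷ false ∷ false ∷ true ∷ false ∷ false ∷ false ∷ true ∷ []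

  Vec₂ : Set
  Vec₂ = Bool × Bool

  0ᵥ : Vec₂
  0ᵥ = false , false

  infixr 5 _+ᵥ_
  _+ᵥ_ : Vec₂ → Vec₂ → Vec₂
  (a , b) +ᵥ (c , d) = a xor c , b xor d

  _*ᵥ_ : Bool → Vec₂ → Vec₂
  t *ᵥ (a , b) = t ∧ a , t ∧ b

  dot : Vec₂ → Vec₂ → Bool
  dot (a , b) (c , d) = (a ∧ c) xor (b ∧ d)

  apply : Vec₂ → Vec₂ → Vec₂ → Vec₂
  apply m₀ m₁ (v₀ , v₁) = v₀ *ᵥ m₀ +ᵥ v₁ *ᵥ m₁

  data Annihilated (A : Vec₂ → Vec₂) (v : Vec₂) : Set where
    by-x       : A v ≡ 0ᵥ → Annihilated A v
    by-x+1     : A v ≡ v → Annihilated A v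
    by-x²+x+1 : A (A v) +ᵥ A v +ᵥ v ≡ 0ᵥ → Annihilated A v

  -- x, x + 1 and x² + x + 1 are the irreducible factors a characteristic polynomial of degree 2 over 𝔽₂ can have.
  annihilated : ∀ m₀ m₁ → Σ Vec₂ λ v → v ≢ 0ᵥ × Annihilated (apply m₀ m₁) v
  annihilated (false , false) (false , false) = (true , false) , (λ ()) , by-x refl
  annihilated (false , false) (false , true)  = (true , false) , (λ ()) , by-x refl
  annihilated (false , false) (true  , false) = (true , false) , (λ ()) , by-x refl
  annihilated (false , false) (true  , true)  = (true , false) , (λ ()) , by-x refl
  annihilated (false , true)  (false , false) = (false , true) , (λ ()) , by-x refl
  annihilated (false , true)  (false , true)  = (true , true)  , (λ ()) , by-x refl
  annihilated (false , true)  (true  , false) = (true , true)  , (λ ()) , by-x+1 refl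
  annihilated (false , true)  (true  , true)  = (true , false) , (λ ()) , by-x²+x+1 refl
  annihilated (true  , false) (false , false) = (false , true) , (λ ()) , by-x refl
  annihilated (true  , false) (false , true)  = (true , false) , (λ ()) , by-x+1 refl
  annihilated (true  , false) (true  , false) = (true , true)  , (λ ()) , by-x refl
  annihilated (true  , false) (true  , true)  = (true , false) , (λ ()) , by-x+1 refl
  annihilated (true  , true)  (false , false) = (false , true) , (λ ()) , by-x refl
  annihilated (true  , true)  (false , true)  = (false , true) , (λ ()) , by-x+1 refl
  annihilated (true  , true)  (true  , false) = (true , false) , (λ ()) , by-x²+x+1 refl
  annihilated (true  , true)  (true  , true)  = (true , true)  , (λ ()) , by-x refl

  ∧-≡-true : ∀ a {b} → a ∧ b ≡ true → a ≡ true × b ≡ true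
  ∧-≡-true true refl = refl , refl

  ∀ᵥ : (Vec₂ → Bool) → Bool
  ∀ᵥ P = P (false , false) ∧ (P (false , true) ∧ (P (true , false) ∧ P (true , true)))

  ∀ᵥ-sound : ∀ P → ∀ᵥ P ≡ true → ∀ v → P v ≡ true
  ∀ᵥ-sound P h (false , false) = proj₁ (∧-≡-true _ h)
  ∀ᵥ-sound P h (false , true)  = proj₁ (∧-≡-true _ (proj₂ (∧-≡-true (P (false , false)) h)))
  ∀ᵥ-sound P h (true  , false) = proj₁ (∧-≡-true _ (proj₂ (∧-≡-true (P (false , true))
                                   (proj₂ (∧-≡-true (P (false , false)) h)))))
  ∀ᵥ-sound P h (true  , true)  = proj₂ (∧-≡-true (P (true , false)) (proj₂ (∧-≡-true (P (false , true))
                                   (proj₂ (∧-≡-true (P (false , false)) h)))))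

  ∀ⁿ : ∀ k → (Vec Vec₂ k → Bool) → Bool
  ∀ⁿ zero    P = P []
  ∀ⁿ (suc k) P = ∀ᵥ λ v → ∀ⁿ k (P ∘ (v ∷_))

  ∀ⁿ-sound : ∀ k P → ∀ⁿ k P ≡ true → ∀ vs → P vs ≡ true
  ∀ⁿ-sound zero    P h []       = h
  ∀ⁿ-sound (suc k) P h (v ∷ vs) = ∀ⁿ-sound k (P ∘ (v ∷_)) (∀ᵥ-sound (λ v → ∀ⁿ k (P ∘ (v ∷_))) h v) vs

  dual? : Vec Vec₂ 3 → Vec Vec₂ 3 → Bool
  dual? c e = does (Listₚ.≡-dec Boolₚ._≟_ (entries₃ (λ k l → dot (lookup c k) (lookup e l))) identity₃)

  never-dual : ∀ⁿ 3 (λ c → ∀ⁿ 3 (λ e → not (dual? c e))) ≡ true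
  never-dual = refl

  rank≤2 : ∀ (c e : Fin 3 → Vec₂) → entries₃ (λ k l → dot (c k) (e l)) ≢ identity₃
  rank≤2 c e eq = true≢false (begin
    true                                           ≡⟨ dec-true (Listₚ.≡-dec Boolₚ._≟_ _ identity₃) tabulated ⟨
    dual? (tabulate c) (tabulate e)                ≡⟨ Boolₚ.not-involutive _ ⟨
    not (not (dual? (tabulate c) (tabulate e)))    ≡⟨ cong not (∀ⁿ-sound 3 (not ∘ dual? (tabulate c))
                                                        (∀ⁿ-sound 3 (λ c → ∀ⁿ 3 (not ∘ dual? c)) never-dual (tabulate c))
                                                        (tabulate e)) ⟩
    false                                          ∎)
    where
    open ≡-Reasoning
    tabulated : entries₃ (λ k l → dot (lookup (tabulate c) k) (lookup (tabulate e) l)) ≡ identity₃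
    tabulated = trans (Listₚ.map-cong (λ (k , l) → cong₂ dot (Vecₚ.lookup∘tabulate c k) (Vecₚ.lookup∘tabulate e l))
                                      (cartesianProduct (allFin 3) (allFin 3))) eq

module Solutions where

  open LocalForm using (Δ₁; Δ₂; fivePoint; Local)
  open LinearAlgebra₂ using (entries₃; identity₃)
  open Mirrors
  open Periods using (Δ; xor≡false⇒≡; Δ≡0⇒period-2; Δ≡id⇒period-3; Δ²+Δ+1≡0⇒period-5)
  open import Data.Integer using (ℤ; _+_; _-_; 1ℤ)
  open import Data.Nat.Divisibility using (_∣_)
  open import Data.Nat.Primality using (Prime; prime?)
  open import Relation.Nullary.Decidable using (from-yes)

  _⊕_ : (ℤ → ℤ → Bool) → (ℤ → ℤ → Bool) → ℤ → ℤ → Bool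
  (F ⊕ G) i j = F i j xor G i j

  _·_ : Bool → (ℤ → ℤ → Bool) → ℤ → ℤ → Bool
  (c · F) i j = c ∧ F i j

  infixl 6 _⊕_
  infixl 7 _·_

  record Mirror² (N : ℕ) (F : ℤ → ℤ → Bool) : Set where
    field
      rows    : ∀ j → Mirror N (λ i → F i j)
      columns : ∀ i → Mirror N (F i)

  open Mirror² public

  record Solution (N : ℕ) (F : ℤ → ℤ → Bool) : Set where
    field
      local   : Local F
      mirror² : Mirror² N F

  open Solution public

  Nonzero : (ℤ → ℤ → Bool) → Set
  Nonzero F = ∃ λ i → ∃ λ j → F i j ≡ true

  -- A certificate that three solutions are linearly independent.
  record DualTriple (N : ℕ) : Set where
    field
      grid     : Fin 3 → ℤ → ℤ → Bool
      solution : ∀ k → Solution N (grid k)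
      point    : Fin 3 → ℤ × ℤ
      dual     : entries₃ (λ k l → grid k (proj₁ (point l)) (proj₂ (point l))) ≡ identity₃

  module _ {N : ℕ} where

    mirror²-⊕ : ∀ {F G} → Mirror² N F → Mirror² N G → Mirror² N (F ⊕ G)
    mirror²-⊕ mF mG = record
      { rows    = λ j → mirror-xor (rows mF j) (rows mG j)
      ; columns = λ i → mirror-xor (columns mF i) (columns mG i)
      }

    mirror²-· : ∀ c {F} → Mirror² N F → Mirror² N (c · F)
    mirror²-· c mF = record
      { rows    = λ j → mirror-∧ c (rows mF j)
      ; columns = λ i → mirror-∧ c (columns mF i)
      }

    mirror²-Δ₁ : ∀ {F} → Mirror² N F → Mirror² N (Δ₁ F)
    mirror²-Δ₁ mF = record
      { rows    = λ j → mirror-Δ (rows mF j)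
      ; columns = λ i → mirror-xor (columns mF (i - 1ℤ)) (columns mF (i + 1ℤ))
      }

    mirror²-Δ₂ : ∀ {F} → Mirror² N F → Mirror² N (Δ₂ F)
    mirror²-Δ₂ mF = record
      { rows    = λ j → mirror-xor (rows mF (j - 1ℤ)) (rows mF (j + 1ℤ))
      ; columns = λ i → mirror-Δ (columns mF i)
      }

    mirror²-fivePoint : ∀ {F} → Mirror² N F → Mirror² N (fivePoint F)
    mirror²-fivePoint mF = mirror²-⊕ mF (mirror²-⊕ (mirror²-Δ₁ mF) (mirror²-Δ₂ mF))

    solution-lincomb : ∀ {F G} a b → Solution N F → Solution N G → Solution N (a · F ⊕ b · G)
    solution-lincomb {F} {G} a b sF sG = record
      { local   = λ i j → trans (distribute a b (F i j) (F (i - 1ℤ) j) (F (i + 1ℤ) j) (F i (j - 1ℤ)) (F i (j + 1ℤ))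
                                                    (G i j) (G (i - 1ℤ) j) (G (i + 1ℤ) j) (G i (j - 1ℤ)) (G i (j + 1ℤ)))
                          (trans (cong₂ (λ f g → (a ∧ f) xor (b ∧ g)) (local sF i j) (local sG i j))
                                 (cong₂ _xor_ (Boolₚ.∧-zeroʳ a) (Boolₚ.∧-zeroʳ b)))
      ; mirror² = mirror²-⊕ (mirror²-· a (mirror² sF)) (mirror²-· b (mirror² sG))
      }
      where
      distribute : ∀ a b f₀ f₁ f₂ f₃ f₄ g₀ g₁ g₂ g₃ g₄ →
        ((a ∧ f₀) xor (b ∧ g₀))
          xor ((((a ∧ f₁) xor (b ∧ g₁)) xor ((a ∧ f₂) xor (b ∧ g₂))) xor (((a ∧ f₃) xor (b ∧ g₃)) xor ((a ∧ f₄) xor (b ∧ g₄))))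
        ≡ (a ∧ (f₀ xor ((f₁ xor f₂) xor (f₃ xor f₄)))) xor (b ∧ (g₀ xor ((g₁ xor g₂) xor (g₃ xor g₄))))
      distribute = solve 12 (λ a b f₀ f₁ f₂ f₃ f₄ g₀ g₁ g₂ g₃ g₄ →
        ((a :* f₀) :+ (b :* g₀))
          :+ ((((a :* f₁) :+ (b :* g₁)) :+ ((a :* f₂) :+ (b :* g₂))) :+ (((a :* f₃) :+ (b :* g₃)) :+ ((a :* f₄) :+ (b :* g₄))))
        := (a :* (f₀ :+ ((f₁ :+ f₂) :+ (f₃ :+ f₄)))) :+ (b :* (g₀ :+ ((g₁ :+ g₂) :+ (g₃ :+ g₄))))) refl

    solution-Δ₁ : ∀ {F} → Solution N F → Solution N (Δ₁ F)
    solution-Δ₁ {F} sF = record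
      { local   = λ i j → trans (regroup (F (i - 1ℤ) j) (F (i + 1ℤ) j)
                                         (F (i - 1ℤ - 1ℤ) j) (F (i - 1ℤ + 1ℤ) j) (F (i + 1ℤ - 1ℤ) j) (F (i + 1ℤ + 1ℤ) j)
                                         (F (i - 1ℤ) (j - 1ℤ)) (F (i + 1ℤ) (j - 1ℤ)) (F (i - 1ℤ) (j + 1ℤ)) (F (i + 1ℤ) (j + 1ℤ)))
                                (cong₂ _xor_ (local sF (i - 1ℤ) j) (local sF (i + 1ℤ) j))
      ; mirror² = mirror²-Δ₁ (mirror² sF)
      }
      where
      regroup : ∀ l r ll lr rl rr ld rd lu ru →
        (l xor r) xor (((ll xor lr) xor (rl xor rr)) xor ((ld xor rd) xor (lu xor ru)))
        ≡ (l xor ((ll xor lr) xor (ld xor lu))) xor (r xor ((rl xor rr) xor (rd xor ru)))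
      regroup = solve 10 (λ l r ll lr rl rr ld rd lu ru →
        (l :+ r) :+ (((ll :+ lr) :+ (rl :+ rr)) :+ ((ld :+ rd) :+ (lu :+ ru)))
        := (l :+ ((ll :+ lr) :+ (ld :+ lu))) :+ (r :+ ((rl :+ rr) :+ (rd :+ ru)))) refl

    solution-multiple : ∀ {F} → Solution N F → ∀ k → Solution (suc k ℕ.* N) F
    solution-multiple sF k = record
      { local   = local sF
      ; mirror² = record { rows    = λ j → mirror-multiple (rows (mirror² sF) j) k
                         ; columns = λ i → mirror-multiple (columns (mirror² sF) i) k }
      }

    dualTriple-multiple : DualTriple N → ∀ k → DualTriple (suc k ℕ.* N)
    dualTriple-multiple t k = record
      { grid = grid ; solution = λ i → solution-multiple (solution i) k ; point = point ; dual = dual }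
      where open DualTriple t

    private
      prime-3 : Prime 3
      prime-3 = from-yes (prime? 3)
      prime-5 : Prime 5
      prime-5 = from-yes (prime? 5)
      2<3 : 2 < 3
      2<3 = ℕₚ.n<1+n 2
      2<5 : 2 < 5
      2<5 = s≤s (s≤s (s≤s z≤n))

    Δ₁≡0⇒2∣∧3∣ : ∀ {F} → Solution N F → Nonzero F → (∀ i j → Δ₁ F i j ≡ false) → 2 ∣ N × 3 ∣ N
    Δ₁≡0⇒2∣∧3∣ {F} sF (i₀ , j₀ , F-true) Δ₁F≡0 =
        mirror-period-2 (rows (mirror² sF) j₀) (Δ≡0⇒period-2 λ i → Δ₁F≡0 i j₀) i₀ F-true
      , mirror-period-prime prime-3 2<3 (columns (mirror² sF) i₀) (Δ≡id⇒period-3 Δcolumn≡column) j₀ F-true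
      where
      Δcolumn≡column : ∀ j → Δ (F i₀) j ≡ F i₀ j
      Δcolumn≡column j =
        sym (xor≡false⇒≡ (trans (cong (λ t → F i₀ j xor (t xor Δ (F i₀) j)) (sym (Δ₁F≡0 i₀ j))) (local sF i₀ j)))

    Δ₁≡id⇒2∣∧3∣ : ∀ {F} → Solution N F → Nonzero F → (∀ i j → Δ₁ F i j ≡ F i j) → 2 ∣ N × 3 ∣ N
    Δ₁≡id⇒2∣∧3∣ {F} sF (i₀ , j₀ , F-true) Δ₁F≡F =
        mirror-period-2 (columns (mirror² sF) i₀) (Δ≡0⇒period-2 Δcolumn≡0) j₀ F-true
      , mirror-period-prime prime-3 2<3 (rows (mirror² sF) j₀) (Δ≡id⇒period-3 λ i → Δ₁F≡F i j₀) i₀ F-true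
      where
      cancel : ∀ a b → a xor (a xor b) ≡ b
      cancel = solve 2 (λ a b → a :+ (a :+ b) := b) refl
      Δcolumn≡0 : ∀ j → Δ (F i₀) j ≡ false
      Δcolumn≡0 j = trans (sym (cancel (F i₀ j) (Δ (F i₀) j)))
                          (trans (cong (λ t → F i₀ j xor (t xor Δ (F i₀) j)) (sym (Δ₁F≡F i₀ j))) (local sF i₀ j))

    Δ₁²+Δ₁+1≡0⇒5∣ : ∀ {F} → Solution N F → Nonzero F →
                    (∀ i j → Δ₁ (Δ₁ F) i j xor (Δ₁ F i j xor F i j) ≡ false) → 5 ∣ N
    Δ₁²+Δ₁+1≡0⇒5∣ sF (i₀ , j₀ , F-true) rel =
      mirror-period-prime prime-5 2<5 (rows (mirror² sF) j₀) (Δ²+Δ+1≡0⇒period-5 λ i → rel i j₀) i₀ F-true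

module Folding (n : ℕ) where

  open LocalForm using (zeroExt; zeroExt-toℕ; zeroExt-outˡ; zeroExt-outʳ; toFin?; toFin?-≥; Φ-fivePoint; fivePoint)
  open Mirrors
  open Solutions
  open Periods using (period-ℤ*)
  open import Data.Integer using (ℤ; +_; _+_; _-_; _*_; -_; 1ℤ; -1ℤ)
  import Data.Integer.Properties as ℤₚ
  open import Data.Integer.DivMod using (_%ℕ_; _/ℕ_; a≡a%ℕn+[a/ℕn]*n; n%ℕd<d)
  open import Data.Integer.Tactic.RingSolver using (solve-∀)

  N M : ℕ
  N = suc n
  M = N ℕ.+ N

  open Residues M using (%ℕ-unique)

  -- fold x is the point of [-1, n] to which x is carried by the reflections in the lines -1 and n.
  tent : ℕ → ℤ
  tent r with r ℕ.≤? N
  ... | yes _ = + r - 1ℤ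
  ... | no  _ = + (M ℕ.∸ suc r)

  fold : ℤ → ℤ
  fold x = tent ((x + 1ℤ) %ℕ M)

  data InRange : ℤ → Set where
    low  : InRange -1ℤ
    high : InRange (+ n)
    box  : (a : Fin n) → InRange (+ toℕ a)

  tent-≤ : ∀ {r} → r ≤ N → tent r ≡ + r - 1ℤ
  tent-≤ {r} r≤N with r ℕ.≤? N
  ... | yes _   = refl
  ... | no  r≰N = ⊥-elim (r≰N r≤N)

  tent-> : ∀ {r} → N < r → tent r ≡ + (M ℕ.∸ suc r)
  tent-> {r} N<r with r ℕ.≤? N
  ... | yes r≤N = ⊥-elim (ℕₚ.<⇒≱ N<r r≤N)
  ... | no  _   = refl

  inRange-+ : ∀ a → a ≤ n → InRange (+ a)
  inRange-+ a a≤n with ℕₚ.m≤n⇒m<n∨m≡n a≤n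
  ... | inj₁ a<n  = subst (InRange ∘ +_) (Finₚ.toℕ-fromℕ< a<n) (box (fromℕ< a<n))
  ... | inj₂ refl = high

  inRange-pred : ∀ a → a ≤ n → InRange (+ a - 1ℤ)
  inRange-pred zero    _       = low
  inRange-pred (suc a) suc-a≤n = inRange-+ a (ℕₚ.<⇒≤ suc-a≤n)

  N<M : N < M
  N<M = ℕₚ.m<m+n N (s≤s z≤n)

  private
    M∸suc≤n : ∀ {r} → N < r → M ℕ.∸ suc r ≤ n
    M∸suc≤n {r} N<r = ℕₚ.m≤n+o⇒m∸n≤o M (suc r) (begin
      N ℕ.+ N        ≤⟨ ℕₚ.+-monoˡ-≤ N (ℕₚ.<⇒≤ N<r) ⟩
      r ℕ.+ suc n    ≡⟨ ℕₚ.+-suc r n ⟩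
      suc r ℕ.+ n    ∎)
      where open ℕₚ.≤-Reasoning

  tent-inRange : ∀ r → InRange (tent r)
  tent-inRange r with r ℕ.≤? N
  tent-inRange zero    | yes _   = low
  tent-inRange (suc a) | yes r≤N = inRange-+ a (ℕₚ.≤-pred r≤N)
  tent-inRange r       | no  r≰N = inRange-+ (M ℕ.∸ suc r) (M∸suc≤n (ℕₚ.≰⇒> r≰N))

  fold-inRange : ∀ x → InRange (fold x)
  fold-inRange x = tent-inRange ((x + 1ℤ) %ℕ M)

  fold-+ : ∀ a → a ≤ n → fold (+ a) ≡ + a
  fold-+ a a≤n = begin
    fold (+ a)              ≡⟨⟩
    tent ((a ℕ.+ 1) ℕ.% M)  ≡⟨ cong tent (ℕDivMod.m<n⇒m%n≡m (ℕₚ.≤-<-trans a+1≤N N<M)) ⟩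
    tent (a ℕ.+ 1)          ≡⟨ cong tent (ℕₚ.+-comm a 1) ⟩
    tent (suc a)            ≡⟨ tent-≤ (s≤s a≤n) ⟩
    + a                     ∎
    where
    open ≡-Reasoning
    a+1≤N : a ℕ.+ 1 ≤ N
    a+1≤N = subst (_≤ N) (ℕₚ.+-comm 1 a) (s≤s a≤n)

  fold-fixes : ∀ {y} → InRange y → fold y ≡ y
  fold-fixes low     = refl
  fold-fixes high    = fold-+ n ℕₚ.≤-refl
  fold-fixes (box a) = fold-+ (toℕ a) (ℕₚ.<⇒≤ (Finₚ.toℕ<n a))

  private
    +∸ : ∀ {m k} → k ≤ m → + (m ℕ.∸ k) ≡ + m - + k
    +∸ {m} {k} k≤m = trans (sym (ℤₚ.⊖-≥ k≤m)) (sym (ℤₚ.m-n≡m⊖n m k))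

    remainder : ∀ x → + ((x + 1ℤ) %ℕ M) ≡ x + 1ℤ - (x + 1ℤ) /ℕ M * + M
    remainder x = trans (cancel (+ ((x + 1ℤ) %ℕ M)) ((x + 1ℤ) /ℕ M * + M))
                        (cong (_- (x + 1ℤ) /ℕ M * + M) (sym (a≡a%ℕn+[a/ℕn]*n (x + 1ℤ) M)))
      where
      cancel : ∀ a b → a ≡ a + b - b
      cancel = solve-∀

  mirror-fold : ∀ {g} → Mirror N g → ∀ x → g (fold x) ≡ g x
  mirror-fold {g} mg x with ℕₚ.≤-<-connex ((x + 1ℤ) %ℕ M) N
  ... | inj₁ r≤N = begin
    g (tent r)                  ≡⟨ cong g (tent-≤ r≤N) ⟩
    g (+ r - 1ℤ)                ≡⟨ cong g (trans (cong (_- 1ℤ) (remainder x)) (unwind x q (+ M))) ⟩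
    g (x + (- q) * + M)         ≡⟨ period-ℤ* (periodic mg) (- q) x ⟩
    g x                         ∎
    where
    open ≡-Reasoning
    r = (x + 1ℤ) %ℕ M
    q = (x + 1ℤ) /ℕ M
    unwind : ∀ x q m → x + 1ℤ - q * m - 1ℤ ≡ x + (- q) * m
    unwind = solve-∀
  ... | inj₂ N<r = begin
    g (tent r)                          ≡⟨ cong g (tent-> N<r) ⟩
    g (+ (M ℕ.∸ suc r))                 ≡⟨ cong g (+∸ (n%ℕd<d (x + 1ℤ) M)) ⟩
    g (+ M - (1ℤ + + r))                ≡⟨ cong g (cong (λ s → + M - (1ℤ + s)) (remainder x)) ⟩
    g (+ M - (1ℤ + (x + 1ℤ - q * + M))) ≡⟨ cong g (unwind x q (+ M)) ⟩
    g (- (x + (- q - 1ℤ) * + M) - + 2)  ≡⟨ reflect mg _ ⟩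
    g (x + (- q - 1ℤ) * + M)            ≡⟨ period-ℤ* (periodic mg) (- q - 1ℤ) x ⟩
    g x                                 ∎
    where
    open ≡-Reasoning
    r = (x + 1ℤ) %ℕ M
    q = (x + 1ℤ) /ℕ M
    unwind : ∀ x q m → m - (1ℤ + (x + 1ℤ - q * m)) ≡ - (x + (- q - 1ℤ) * m) - + 2
    unwind = solve-∀

  fold-periodic : ∀ x → fold (x + + M) ≡ fold x
  fold-periodic x = cong tent (%ℕ-unique (x + + M + 1ℤ) r (q + 1ℤ) (n%ℕd<d (x + 1ℤ) M) (begin
    x + + M + 1ℤ             ≡⟨ swap x (+ M) ⟩
    x + 1ℤ + + M             ≡⟨ cong (_+ + M) (a≡a%ℕn+[a/ℕn]*n (x + 1ℤ) M) ⟩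
    + r + q * + M + + M      ≡⟨ collect (+ r) q (+ M) ⟩
    + r + (q + 1ℤ) * + M     ∎))
    where
    open ≡-Reasoning
    r = (x + 1ℤ) %ℕ M
    q = (x + 1ℤ) /ℕ M
    swap : ∀ x m → x + m + 1ℤ ≡ x + 1ℤ + m
    swap = solve-∀
    collect : ∀ r q m → r + q * m + m ≡ r + (q + 1ℤ) * m
    collect = solve-∀

  private
    tent-mirror-< : ∀ r → 0 < r → r < N → tent (M ℕ.∸ r) ≡ tent r
    tent-mirror-< (suc r) _ r<N = begin
      tent (M ℕ.∸ suc r)                  ≡⟨ tent-> N<M∸r ⟩
      + (M ℕ.∸ suc (M ℕ.∸ suc r))         ≡⟨ cong (λ m → + (M ℕ.∸ m)) (ℕₚ.+-∸-assoc 1 r<M) ⟨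
      + (M ℕ.∸ (M ℕ.∸ r))                 ≡⟨ cong +_ (ℕₚ.m∸[m∸n]≡n (ℕₚ.<⇒≤ r<M)) ⟩
      + r                                 ≡⟨ tent-≤ (ℕₚ.<⇒≤ r<N) ⟨
      tent (suc r)                        ∎
      where
      open ≡-Reasoning
      r<M : suc r ≤ M
      r<M = ℕₚ.<⇒≤ (ℕₚ.<-trans r<N N<M)
      N<M∸r : N < M ℕ.∸ suc r
      N<M∸r = ℕₚ.m+n≤o⇒m≤o∸n (suc N) (subst (_≤ M) (ℕₚ.+-suc N (suc r)) (ℕₚ.+-monoʳ-≤ N r<N))

  tent-mirror : ∀ r → 0 < r → r < M → tent (M ℕ.∸ r) ≡ tent r
  tent-mirror r 0<r r<M with ℕₚ.<-cmp r N
  ... | tri< r<N _ _ = tent-mirror-< r 0<r r<N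
  ... | tri≈ _ refl _ = cong tent (ℕₚ.m+n∸n≡m N N)
  ... | tri> _ _ N<r = begin
    tent (M ℕ.∸ r)                 ≡⟨ tent-mirror-< (M ℕ.∸ r) (ℕₚ.m<n⇒0<n∸m r<M) M∸r<N ⟨
    tent (M ℕ.∸ (M ℕ.∸ r))         ≡⟨ cong tent (ℕₚ.m∸[m∸n]≡n (ℕₚ.<⇒≤ r<M)) ⟩
    tent r                         ∎
    where
    open ≡-Reasoning
    M∸r<N : M ℕ.∸ r < N
    M∸r<N = s≤s (ℕₚ.m≤n+o⇒m∸n≤o M r
                   (ℕₚ.≤-pred (subst (suc M ≤_) (ℕₚ.+-suc r n) (ℕₚ.+-monoˡ-≤ N N<r))))

  tent-%ℕ-neg : ∀ y → tent ((- y) %ℕ M) ≡ tent (y %ℕ M)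
  tent-%ℕ-neg y with y %ℕ M | n%ℕd<d y M | a≡a%ℕn+[a/ℕn]*n y M
  ... | zero  | _   | y≡ = cong tent (%ℕ-unique (- y) 0 (- q) (s≤s z≤n) (trans (cong -_ y≡) (negate₀ q (+ M))))
    where
    q = y /ℕ M
    negate₀ : ∀ q m → - (+ 0 + q * m) ≡ + 0 + (- q) * m
    negate₀ = solve-∀
  ... | suc r | r<M | y≡ = trans (cong tent (%ℕ-unique (- y) (M ℕ.∸ suc r) (- q - 1ℤ) M∸r<M (begin
      - y                                     ≡⟨ cong -_ y≡ ⟩
      - (+ suc r + q * + M)                   ≡⟨ negate₊ (+ suc r) q (+ M) ⟩
      + M - + suc r + (- q - 1ℤ) * + M        ≡⟨ cong (_+ (- q - 1ℤ) * + M) (+∸ (ℕₚ.<⇒≤ r<M)) ⟨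
      + (M ℕ.∸ suc r) + (- q - 1ℤ) * + M      ∎)))
    (tent-mirror (suc r) (s≤s z≤n) r<M)
    where
    open ≡-Reasoning
    q = y /ℕ M
    M∸r<M : M ℕ.∸ suc r < M
    M∸r<M = ℕₚ.∸-monoʳ-< (s≤s z≤n) (ℕₚ.<⇒≤ r<M)
    negate₊ : ∀ r q m → - (r + q * m) ≡ m - r + (- q - 1ℤ) * m
    negate₊ = solve-∀

  fold-reflect : ∀ x → fold (- x - + 2) ≡ fold x
  fold-reflect x = trans (cong (λ y → tent (y %ℕ M)) (negate x)) (tent-%ℕ-neg (x + 1ℤ))
    where
    negate : ∀ x → - x - + 2 + 1ℤ ≡ - (x + 1ℤ)
    negate = solve-∀

  fold-mirror : ∀ (h : ℤ → Bool) → h -1ℤ ≡ false → h (+ n) ≡ false → Mirror N (h ∘ fold)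
  fold-mirror h h-low h-high = record
    { periodic = cong h ∘ fold-periodic
    ; reflect  = cong h ∘ fold-reflect
    ; at-1     = h-low
    ; at-N-1   = trans (cong h (fold-fixes high)) h-high
    }

  extend : Subset n → ℤ → ℤ → Bool
  extend S i j = zeroExt S (fold i) (fold j)

  restrict : (ℤ → ℤ → Bool) → Subset n
  restrict F (a , b) = F (+ toℕ a) (+ toℕ b)

  mirror²-fold : ∀ {F} → Mirror² N F → ∀ i j → F (fold i) (fold j) ≡ F i j
  mirror²-fold mF i j = trans (mirror-fold (rows mF (fold j)) i) (mirror-fold (columns mF i) j)

  mirror²-vanishing : ∀ {G} → Mirror² N G → (∀ (a b : Fin n) → G (+ toℕ a) (+ toℕ b) ≡ false) →
                      ∀ i j → G i j ≡ false
  mirror²-vanishing {G} mG G-box i j = trans (sym (mirror²-fold mG i j)) (on-range (fold-inRange i) (fold-inRange j))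
    where
    on-range : ∀ {y z} → InRange y → InRange z → G y z ≡ false
    on-range {z = z} low     _       = at-1 (rows mG z)
    on-range {z = z} high    _       = at-N-1 (rows mG z)
    on-range (box a) low             = at-1 (columns mG (+ toℕ a))
    on-range (box a) high            = at-N-1 (columns mG (+ toℕ a))
    on-range (box a) (box b)         = G-box a b

  fivePoint-box : ∀ {F G} → (∀ {y z} → InRange y → InRange z → F y z ≡ G y z) →
                  ∀ (a b : Fin n) → fivePoint F (+ toℕ a) (+ toℕ b) ≡ fivePoint G (+ toℕ a) (+ toℕ b)
  fivePoint-box F≡G a b =
    cong₂ _xor_ (F≡G (box a) (box b))
      (cong₂ _xor_ (cong₂ _xor_ (F≡G (below a) (box b)) (F≡G (above a) (box b)))
                   (cong₂ _xor_ (F≡G (box a) (below b)) (F≡G (box a) (above b))))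
    where
    below : ∀ (a : Fin n) → InRange (+ toℕ a - 1ℤ)
    below a = inRange-pred (toℕ a) (ℕₚ.<⇒≤ (Finₚ.toℕ<n a))
    above : ∀ (a : Fin n) → InRange (+ toℕ a + 1ℤ)
    above a = inRange-+ (toℕ a ℕ.+ 1) (subst (_≤ n) (ℕₚ.+-comm 1 (toℕ a)) (Finₚ.toℕ<n a))

  extend-agrees : ∀ S {y z} → InRange y → InRange z → extend S y z ≡ zeroExt S y z
  extend-agrees S ry rz = cong₂ (zeroExt S) (fold-fixes ry) (fold-fixes rz)

  extend-box : ∀ S (a b : Fin n) → extend S (+ toℕ a) (+ toℕ b) ≡ S (a , b)
  extend-box S a b = trans (extend-agrees S (box a) (box b)) (zeroExt-toℕ S a b)

  extend-mirror² : ∀ S → Mirror² N (extend S)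
  extend-mirror² S = record
    { rows    = λ j → fold-mirror (λ y → zeroExt S y (fold j)) refl (zeroExt-outˡ S (+ n) (fold j) n-out)
    ; columns = λ i → fold-mirror (zeroExt S (fold i)) (zeroExt-outʳ S (fold i) -1ℤ refl)
                                                        (zeroExt-outʳ S (fold i) (+ n) n-out)
    }
    where
    n-out : toFin? {n} (+ n) ≡ nothing
    n-out = toFin?-≥ n ℕₚ.≤-refl

  extend-solution : ∀ S → InKernel S → Solution N (extend S)
  extend-solution S S∈ker = record
    { local   = mirror²-vanishing (mirror²-fivePoint (extend-mirror² S)) λ a b →
                  trans (fivePoint-box (extend-agrees S) a b) (trans (sym (Φ-fivePoint S a b)) (S∈ker (a , b)))
    ; mirror² = extend-mirror² S
    }

  restrict-agrees : ∀ {F} → Mirror² N F → ∀ {y z} → InRange y → InRange z → zeroExt (restrict F) y z ≡ F y z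
  restrict-agrees     mF {z = z} low      _       = sym (at-1 (rows mF z))
  restrict-agrees {F} mF {z = z} high     _       =
    trans (zeroExt-outˡ (restrict F) (+ n) z (toFin?-≥ n ℕₚ.≤-refl)) (sym (at-N-1 (rows mF z)))
  restrict-agrees {F} mF (box a) low              =
    trans (zeroExt-outʳ (restrict F) (+ toℕ a) -1ℤ refl) (sym (at-1 (columns mF _)))
  restrict-agrees {F} mF (box a) high             =
    trans (zeroExt-outʳ (restrict F) (+ toℕ a) (+ n) (toFin?-≥ n ℕₚ.≤-refl)) (sym (at-N-1 (columns mF _)))
  restrict-agrees {F} mF (box a) (box b)          = zeroExt-toℕ (restrict F) a b

  restrict-kernel : ∀ {F} → Solution N F → InKernel (restrict F)
  restrict-kernel sF (a , b) =
    trans (Φ-fivePoint _ a b) (trans (fivePoint-box (restrict-agrees (mirror² sF)) a b) (local sF _ _))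

  extend-restrict : ∀ {F} → Mirror² N F → ∀ i j → extend (restrict F) i j ≡ F i j
  extend-restrict mF i j = trans (restrict-agrees mF (fold-inRange i) (fold-inRange j)) (mirror²-fold mF i j)

module DimensionTwo (n : ℕ) (basis : KernelDim n 2) where

  open Folding n
  open Solutions
  open Mirrors
  open LocalForm using (Δ₁; cellAt-lincomb; toFin?)
  open LinearAlgebra₂
  open import Data.Integer using (ℤ; +_; _+_; _-_; 1ℤ)
  open import Data.Fin.Patterns using (0F; 1F)
  open import Data.Nat.Divisibility using (_∣_)

  b : Fin 2 → Subset n
  b = proj₁ basis

  in-kernel : ∀ i → InKernel (b i)
  in-kernel = proj₁ (proj₂ basis)

  independent : ∀ c → (∀ u → linComb b c u ≡ false) → ∀ i → c i ≡ false
  independent = proj₁ (proj₂ (proj₂ basis))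

  spanning : ∀ S → InKernel S → ∃ λ c → ∀ u → linComb b c u ≡ S u
  spanning = proj₂ (proj₂ (proj₂ basis))

  b₀ b₁ : Subset n
  b₀ = b 0F
  b₁ = b 1F

  B₀ B₁ : ℤ → ℤ → Bool
  B₀ = extend b₀
  B₁ = extend b₁

  ⟦_⟧ : Vec₂ → ℤ → ℤ → Bool
  ⟦ c₀ , c₁ ⟧ = c₀ · B₀ ⊕ c₁ · B₁

  combination : Vec₂ → Subset n
  combination (c₀ , c₁) u = (c₀ ∧ b₀ u) xor (c₁ ∧ b₁ u)

  coefficients : Vec₂ → Fin 2 → Bool
  coefficients (c₀ , _) 0F = c₀
  coefficients (_ , c₁) 1F = c₁

  linComb-coefficients : ∀ c u → linComb b (coefficients c) u ≡ combination c u
  linComb-coefficients (c₀ , c₁) u = cong ((c₀ ∧ b₀ u) xor_) (Boolₚ.xor-identityʳ (c₁ ∧ b₁ u))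

  basis-solution : ∀ i → Solution N (extend (b i))
  basis-solution i = extend-solution (b i) (in-kernel i)

  ⟦⟧-solution : ∀ c → Solution N ⟦ c ⟧
  ⟦⟧-solution (c₀ , c₁) = solution-lincomb c₀ c₁ (basis-solution 0F) (basis-solution 1F)

  ⟦⟧-box : ∀ c (a b : Fin n) → ⟦ c ⟧ (+ toℕ a) (+ toℕ b) ≡ combination c (a , b)
  ⟦⟧-box (c₀ , c₁) a b = cong₂ (λ x y → (c₀ ∧ x) xor (c₁ ∧ y)) (extend-box b₀ a b) (extend-box b₁ a b)

  ⟦⟧-+ᵥ : ∀ c d i j → ⟦ c ⟧ i j xor ⟦ d ⟧ i j ≡ ⟦ c +ᵥ d ⟧ i j
  ⟦⟧-+ᵥ (c₀ , c₁) (d₀ , d₁) i j = collect c₀ c₁ d₀ d₁ (B₀ i j) (B₁ i j)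
    where
    collect : ∀ c₀ c₁ d₀ d₁ x y →
              ((c₀ ∧ x) xor (c₁ ∧ y)) xor ((d₀ ∧ x) xor (d₁ ∧ y)) ≡ ((c₀ xor d₀) ∧ x) xor ((c₁ xor d₁) ∧ y)
    collect = solve 6 (λ c₀ c₁ d₀ d₁ x y → ((c₀ :* x) :+ (c₁ :* y)) :+ ((d₀ :* x) :+ (d₁ :* y))
                                          := ((c₀ :+ d₀) :* x) :+ ((c₁ :+ d₁) :* y)) refl

  coordinates : ∀ {F} → Solution N F → Σ Vec₂ λ c → ∀ i j → F i j ≡ ⟦ c ⟧ i j
  coordinates {F} sF = c , λ i j →
    trans (sym (extend-restrict (mirror² sF) i j))
          (cellAt-lincomb (proj₁ c) (proj₂ c) restrict≡ (toFin? (fold i)) (toFin? (fold j)))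
    where
    spanned = spanning (restrict F) (restrict-kernel sF)
    c : Vec₂
    c = proj₁ spanned 0F , proj₁ spanned 1F
    restrict≡ : ∀ u → restrict F u ≡ combination c u
    restrict≡ u = trans (sym (proj₂ spanned u)) (linComb-coefficients c u)

  nonzero-cell : ∀ (S : Subset n) → ¬ (∀ u → S u ≡ false) → ∃ λ u → S u ≡ true
  nonzero-cell S S≢0 with Finₚ.any? (λ a → Finₚ.any? (λ b → S (a , b) Boolₚ.≟ true))
  ... | yes (a , b , Sab) = (a , b) , Sab
  ... | no  none          = ⊥-elim (S≢0 λ (a , b) → Boolₚ.¬-not (λ Sab → none (a , b , Sab)))

  has-true-value : ∀ c → c ≢ 0ᵥ → Nonzero ⟦ c ⟧
  has-true-value c c≢0 =
    let (a , b) , true-at = nonzero-cell (combination c) combination≢0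
    in  + toℕ a , + toℕ b , trans (⟦⟧-box c a b) true-at
    where
    combination≢0 : ¬ (∀ u → combination c u ≡ false)
    combination≢0 c≡0 = c≢0 (cong₂ _,_ (coefficients≡0 0F) (coefficients≡0 1F))
      where
      coefficients≡0 = independent (coefficients c) (λ u → trans (linComb-coefficients c u) (c≡0 u))

  Δ₁-basis : ∀ i → Σ Vec₂ λ m → ∀ x y → Δ₁ (extend (b i)) x y ≡ ⟦ m ⟧ x y
  Δ₁-basis i = coordinates (solution-Δ₁ (basis-solution i))

  m₀ m₁ : Vec₂
  m₀ = proj₁ (Δ₁-basis 0F)
  m₁ = proj₁ (Δ₁-basis 1F)

  A : Vec₂ → Vec₂
  A = apply m₀ m₁

  Δ₁-⟦⟧ : ∀ v i j → Δ₁ ⟦ v ⟧ i j ≡ ⟦ A v ⟧ i j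
  Δ₁-⟦⟧ (v₀ , v₁) i j = begin
    Δ₁ ⟦ v₀ , v₁ ⟧ i j
      ≡⟨ split v₀ v₁ (B₀ (i - 1ℤ) j) (B₁ (i - 1ℤ) j) (B₀ (i + 1ℤ) j) (B₁ (i + 1ℤ) j) ⟩
    (v₀ ∧ Δ₁ B₀ i j) xor (v₁ ∧ Δ₁ B₁ i j)
      ≡⟨ cong₂ (λ x y → (v₀ ∧ x) xor (v₁ ∧ y)) (proj₂ (Δ₁-basis 0F) i j) (proj₂ (Δ₁-basis 1F) i j) ⟩
    (v₀ ∧ ⟦ m₀ ⟧ i j) xor (v₁ ∧ ⟦ m₁ ⟧ i j)
      ≡⟨ combine v₀ v₁ (proj₁ m₀) (proj₂ m₀) (proj₁ m₁) (proj₂ m₁) (B₀ i j) (B₁ i j) ⟩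
    ⟦ A (v₀ , v₁) ⟧ i j ∎
    where
    open ≡-Reasoning
    split : ∀ v₀ v₁ p q r s →
            ((v₀ ∧ p) xor (v₁ ∧ q)) xor ((v₀ ∧ r) xor (v₁ ∧ s)) ≡ (v₀ ∧ (p xor r)) xor (v₁ ∧ (q xor s))
    split = solve 6 (λ v₀ v₁ p q r s → ((v₀ :* p) :+ (v₁ :* q)) :+ ((v₀ :* r) :+ (v₁ :* s))
                                      := (v₀ :* (p :+ r)) :+ (v₁ :* (q :+ s))) refl
    combine : ∀ v₀ v₁ a b c d x y → (v₀ ∧ ((a ∧ x) xor (b ∧ y))) xor (v₁ ∧ ((c ∧ x) xor (d ∧ y)))
                                    ≡ (((v₀ ∧ a) xor (v₁ ∧ c)) ∧ x) xor (((v₀ ∧ b) xor (v₁ ∧ d)) ∧ y)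
    combine = solve 8 (λ v₀ v₁ a b c d x y → (v₀ :* ((a :* x) :+ (b :* y))) :+ (v₁ :* ((c :* x) :+ (d :* y)))
                                            := (((v₀ :* a) :+ (v₁ :* c)) :* x) :+ (((v₀ :* b) :+ (v₁ :* d)) :* y)) refl

  Δ₁-⟦⟧≡ : ∀ v {w} → A v ≡ w → ∀ i j → Δ₁ ⟦ v ⟧ i j ≡ ⟦ w ⟧ i j
  Δ₁-⟦⟧≡ v refl = Δ₁-⟦⟧ v

  divisors-from : ∀ v → v ≢ 0ᵥ → Annihilated A v → (2 ∣ N × 3 ∣ N) ⊎ 5 ∣ N
  divisors-from v v≢0 (by-x Av≡0)   = inj₁ (Δ₁≡0⇒2∣∧3∣ (⟦⟧-solution v) (has-true-value v v≢0) (Δ₁-⟦⟧≡ v Av≡0))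
  divisors-from v v≢0 (by-x+1 Av≡v) = inj₁ (Δ₁≡id⇒2∣∧3∣ (⟦⟧-solution v) (has-true-value v v≢0) (Δ₁-⟦⟧≡ v Av≡v))
  divisors-from v v≢0 (by-x²+x+1 AAv+Av+v≡0) =
    inj₂ (Δ₁²+Δ₁+1≡0⇒5∣ (⟦⟧-solution v) (has-true-value v v≢0) annihilates)
    where
    annihilates : ∀ i j → Δ₁ (Δ₁ ⟦ v ⟧) i j xor (Δ₁ ⟦ v ⟧ i j xor ⟦ v ⟧ i j) ≡ false
    annihilates i j = begin
      Δ₁ (Δ₁ ⟦ v ⟧) i j xor (Δ₁ ⟦ v ⟧ i j xor ⟦ v ⟧ i j)
        ≡⟨ cong₂ _xor_ (trans (cong₂ _xor_ (Δ₁-⟦⟧ v (i - 1ℤ) j) (Δ₁-⟦⟧ v (i + 1ℤ) j)) (Δ₁-⟦⟧ (A v) i j))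
                       (cong (_xor ⟦ v ⟧ i j) (Δ₁-⟦⟧ v i j)) ⟩
      ⟦ A (A v) ⟧ i j xor (⟦ A v ⟧ i j xor ⟦ v ⟧ i j)
        ≡⟨ cong (⟦ A (A v) ⟧ i j xor_) (⟦⟧-+ᵥ (A v) v i j) ⟩
      ⟦ A (A v) ⟧ i j xor ⟦ A v +ᵥ v ⟧ i j
        ≡⟨ ⟦⟧-+ᵥ (A (A v)) (A v +ᵥ v) i j ⟩
      ⟦ A (A v) +ᵥ A v +ᵥ v ⟧ i j
        ≡⟨ cong (λ w → ⟦ w ⟧ i j) AAv+Av+v≡0 ⟩
      false ∎
      where open ≡-Reasoning

  divisors : (2 ∣ N × 3 ∣ N) ⊎ 5 ∣ N
  divisors = let v , v≢0 , annihilator = annihilated m₀ m₁ in divisors-from v v≢0 annihilator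

  no-dual-triple : DualTriple N → ⊥
  no-dual-triple t = rank≤2 c e (trans (sym (Listₚ.map-cong on-basis (cartesianProduct (allFin 3) (allFin 3)))) dual)
    where
    open DualTriple t
    c : Fin 3 → Vec₂
    c k = proj₁ (coordinates (solution k))
    e : Fin 3 → Vec₂
    e l = B₀ (proj₁ (point l)) (proj₂ (point l)) , B₁ (proj₁ (point l)) (proj₂ (point l))
    on-basis : ∀ ((k , l) : Fin 3 × Fin 3) → grid k (proj₁ (point l)) (proj₂ (point l)) ≡ dot (c k) (e l)
    on-basis (k , l) = proj₂ (coordinates (solution k)) (proj₁ (point l)) (proj₂ (point l))

module Witnesses where

  open Solutions using (DualTriple; dualTriple-multiple)
  open import Data.Integer using (+_)
  open import Data.Vec using (Vec; []; _∷_; lookup)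
  open import Data.Fin.Patterns using (0F; 1F; 2F)
  open import Data.Nat.Divisibility using (_∣_; divides)
  open import Relation.Nullary.Decidable using (from-yes)
  open import Relation.Nullary using (Dec)

  digit : ℕ → ℕ → ℕ
  digit x zero    = x ℕ.% 10
  digit x (suc k) = digit (x ℕ./ 10) k

  -- Row i is written as a numeral whose n decimal digits, read from the left, are the cells (i , 0), …, (i , n - 1).
  fromRows : ∀ {n} → Vec ℕ n → Subset n
  fromRows {n} rows (i , j) = digit (lookup rows i) (n ℕ.∸ suc (toℕ j)) ≡ᵇ 1

  all-in-kernel? : ∀ {n} (W : Fin 3 → Subset n) → Dec (∀ k a b → Φ (W k) (a , b) ≡ false)
  all-in-kernel? W = Finₚ.all? λ k → Finₚ.all? λ a → Finₚ.all? λ b → Φ (W k) (a , b) Boolₚ.≟ false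

  kernel₄ : Fin 3 → Subset 4
  kernel₄ 0F = fromRows (0111 ∷ 1010 ∷ 1100 ∷ 1000 ∷ [])
  kernel₄ 1F = fromRows (1101 ∷ 0001 ∷ 1110 ∷ 0100 ∷ [])
  kernel₄ 2F = fromRows (1011 ∷ 1000 ∷ 0111 ∷ 0010 ∷ [])

  kernel₁₁ : Fin 3 → Subset 11
  kernel₁₁ 0F = fromRows (01110111011 ∷ 10100010000 ∷ 11000000011 ∷ 10000010100 ∷ 00000110101 ∷ 10001010001
                        ∷ 11011101110 ∷ 10000010100 ∷ 00011011000 ∷ 10100010000 ∷ 10101100000 ∷ [])
  kernel₁₁ 1F = fromRows (10100010000 ∷ 10110111000 ∷ 00100000100 ∷ 11000110110 ∷ 00001000101 ∷ 11011011011
                        ∷ 00001000101 ∷ 11000110110 ∷ 00100000100 ∷ 10110111000 ∷ 10100010000 ∷ [])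
  kernel₁₁ 2F = fromRows (01100010011 ∷ 10010111100 ∷ 10010001001 ∷ 01101100011 ∷ 00010011101 ∷ 01010001010
                        ∷ 11001000110 ∷ 01101100011 ∷ 01001010010 ∷ 10010111100 ∷ 10111001000 ∷ [])

  dualTriple₅ : DualTriple 5
  dualTriple₅ = record
    { grid     = λ k → Folding.extend 4 (kernel₄ k)
    ; solution = λ k → Folding.extend-solution 4 (kernel₄ k) (λ (a , b) → from-yes (all-in-kernel? kernel₄) k a b)
    ; point    = λ l → + 3 , + toℕ l
    ; dual     = refl
    }

  dualTriple₁₂ : DualTriple 12
  dualTriple₁₂ = record
    { grid     = λ k → Folding.extend 11 (kernel₁₁ k)
    ; solution = λ k → Folding.extend-solution 11 (kernel₁₁ k) (λ (a , b) → from-yes (all-in-kernel? kernel₁₁) k a b)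
    ; point    = λ l → + 10 , + (5 ℕ.+ toℕ l)
    ; dual     = refl
    }

  dualTriple-∣ : ∀ {M N} → DualTriple M → M ∣ N → N ≢ 0 → DualTriple N
  dualTriple-∣ t (divides zero    N≡0)     N≢0 = ⊥-elim (N≢0 N≡0)
  dualTriple-∣ t (divides (suc k) N≡k+1*M) _   = subst DualTriple (sym N≡k+1*M) (dualTriple-multiple t k)

open import Data.Nat using (_+_; _%_)
open import Data.Nat.Divisibility using (_∣_)
open Solutions using (DualTriple)
open Witnesses using (dualTriple₅; dualTriple₁₂; dualTriple-∣)
open NumberTheory using (2∣∧3∣∧12∤⇒12∣+6)

corollary6 : (n : ℕ) → 1 ≤ n → KernelDim n 2 → (n + 7) % 12 ≡ 0
corollary6 (suc m) _ basis = from-divisors divisors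
  where
  open DimensionTwo (suc m) basis using (divisors; no-dual-triple)
  N = suc (suc m)
  excluded : ∀ {M} → DualTriple M → ¬ M ∣ N
  excluded t M∣N = no-dual-triple (dualTriple-∣ t M∣N λ ())
  from-divisors : (2 ∣ N × 3 ∣ N) ⊎ 5 ∣ N → (suc m + 7) % 12 ≡ 0
  from-divisors (inj₂ 5∣N)         = ⊥-elim (excluded dualTriple₅ 5∣N)
  from-divisors (inj₁ (2∣N , 3∣N)) =
    trans (cong (λ k → suc k % 12) (ℕₚ.+-suc m 6)) (2∣∧3∣∧12∤⇒12∣+6 N 2∣N 3∣N (excluded dualTriple₁₂))
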